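{- Let $\Gamma_1,\dots,\Gamma_k$ ($k\ge 1$) be finite graphs such that any two of them have exactly one vertex in common, namely the same vertex $\alpha$ for all pairs, and let $\Gamma=\Gamma_1\coprod_\alpha\cdots\coprod_\alpha\Gamma_k$ be the graph obtained from their disjoint union by identifying the copies of $\alpha$. Let $\Pi$ be the vertex set of $\Gamma$, $l=\#\Pi$, and $l_i=\#\Gamma_i$ the number of vertices of $\Gamma_i$, so that $l=\sum_i l_i-k+1$. Let $o\in Or(\Gamma)$ and put $o_i:=o|_{\Gamma_i}\in Or(\Gamma_i)$. Then for every $r\in\mathbb{Z}_{\ge0}$, $$\sigma(o,\alpha,r)=\sum_{\substack{r_1,\dots,r_k\in\mathbb{Z}_{\ge0}\\ r_1+\cdots+r_k=r}}\sigma(o_1,\alpha,r_1)\cdots\sigma(o_k,\alpha,r_k)\binom{r_1+\cdots+r_k}{r_1,\dots,r_k}\binom{l-1-r_1-\cdots-r_k}{l_1-r_1-1,\dots,l_k-r_k-1},$$ and consequently $$\sigma(o)=\sum_{r_1,\dots,r_k\in\mathbb{Z}_{\ge0}}\sigma(o_1,\alpha,r_1)\cdots\sigma(o_k,\alpha,r_k)\binom{r_1+\cdots+r_k}{r_1,\dots,r_k}\binom{l-1-r_1-\cdots-r_k}{l_1-r_1-1,\dots,l_k-r_k-1},$$ where $\binom{n_1+\cdots+n_k}{n_1,\dots,n_k}=(n_1+\cdots+n_k)!/(n_1!\cdots n_k!)$ is the multinomial coefficient.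
   Context: A graph on a finite set $\Pi$ is a simple graph (1-dimensional simplicial complex) with vertex set $\Pi$. An acyclic orientation $o$ of a graph $\Gamma$ on $\Pi$ is a choice of direction $\alpha<_o\beta$ for each edge $\overline{\alpha\beta}$ such that there is no directed cycle; $Or(\Gamma)$ denotes the set of acyclic orientations, and $o|_{\Gamma'}$ denotes the restriction of $o$ to the edges of a subgraph $\Gamma'$. For $o\in Or(\Gamma)$, $\Sigma(o)$ is the set of linear orderings $c$ of $\Pi$ such that $\alpha<_c\beta$ for every edge oriented $\alpha<_o\beta$ (these correspond to the chambers of the type $A_{l-1}$ reflection arrangement contained in the $\Gamma$-cone of $o$), and $\sigma(o)=\#\Sigma(o)$. For a vertex $\alpha$ and $r\in\mathbb{Z}_{\ge0}$, $\Sigma(o,\alpha,r):=\{c\in\Sigma(o)\mid \#\{\beta\in\Pi\mid\alpha<_c\beta\}=r\}$ and $\sigma(o,\alpha,r):=\#\Sigma(o,\alpha,r)$. -}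

module Defs where

open import Data.Nat using (ℕ; zero; suc; _+_; _*_; _∸_; _/_; _≡ᵇ_; NonZero)
open import Data.Nat.Properties using (_!≢0; m*n≢0)
open import Data.Nat.Base using (_!)
open import Data.Bool using (Bool; true; false; _∧_; not; if_then_else_)
open import Data.List using (List; []; _∷_; map; concatMap; filterᵇ; length)
open import Data.Bool.ListAction using (and)
open import Data.List.Membership.Propositional using (_∈_)
open import Data.List.Relation.Unary.Unique.Propositional using (Unique)
open import Data.Vec using (Vec; []; _∷_; lookup)
open import Data.Fin using (Fin; zero; suc)
open import Data.Product using (_×_; ∃)
open import Data.Sum using (_⊎_)
open import Relation.Nullary using (¬_; does)
open import Relation.Binary.Definitions using (DecidableEquality)
open import Relation.Binary.PropositionalEquality using (_≡_)
open import Relation.Binary.Construct.Closure.Transitive using (TransClosure)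

vsum : ∀ {k} → Vec ℕ k → ℕ
vsum []       = 0
vsum (x ∷ xs) = x + vsum xs

prodFact : ∀ {k} → Vec ℕ k → ℕ
prodFact []       = 1
prodFact (x ∷ xs) = x ! * prodFact xs

prodFact≢0 : ∀ {k} (v : Vec ℕ k) → NonZero (prodFact v)
prodFact≢0 []       = _
prodFact≢0 (x ∷ xs) = m*n≢0 (x !) (prodFact xs) {{x !≢0}} {{prodFact≢0 xs}}

multinomial : ∀ {k} → Vec ℕ k → ℕ
multinomial v = ((vsum v) ! / prodFact v) {{prodFact≢0 v}}

sumUpTo : ℕ → (ℕ → ℕ) → ℕ
sumUpTo zero    f = f 0
sumUpTo (suc n) f = sumUpTo n f + f (suc n)

-- sum of f (r₁,…,rₖ) over all (r₁,…,rₖ) ∈ ℕᵏ with r₁+⋯+rₖ = r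
sumComp : (k r : ℕ) → (Vec ℕ k → ℕ) → ℕ
sumComp zero    zero    f = f []
sumComp zero    (suc r) f = 0
sumComp (suc k) r       f = sumUpTo r (λ j → sumComp k (r ∸ j) (λ v → f (j ∷ v)))

sumBox : (k N : ℕ) → (Vec ℕ k → ℕ) → ℕ
sumBox zero    N f = f []
sumBox (suc k) N f = sumUpTo N (λ j → sumBox k N (λ v → f (j ∷ v)))

module _ {A : Set} where

  record Graph : Set where
    field
      verts   : List A
      uniq    : Unique verts
      adj     : A → A → Bool
      adj-sym : ∀ a b → adj a b ≡ adj b a
      adj-irr : ∀ a → adj a a ≡ false
      adj-in  : ∀ a b → adj a b ≡ true → a ∈ verts × b ∈ verts
  open Graph public

  #V : Graph → ℕ
  #V Γ = length (verts Γ)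

  -- An orientation is a boolean relation  o a b = true  meaning  a <_o b.
  record IsAcyclicOrientation (Γ : Graph) (o : A → A → Bool) : Set where
    field
      only-edges : ∀ a b → o a b ≡ true → adj Γ a b ≡ true
      all-edges  : ∀ a b → adj Γ a b ≡ true → o a b ≡ true ⊎ o b a ≡ true
      one-dir    : ∀ a b → o a b ≡ true → o b a ≡ false
      acyclic    : ∀ a → ¬ TransClosure (λ x y → o x y ≡ true) a a

  restrict : (A → A → Bool) → Graph → (A → A → Bool)
  restrict o Γ' a b = o a b ∧ adj Γ' a b

  -- all orderings (permutations) of a list; for a duplicate-free list Π these
  -- are exactly the linear orderings of the set Π, each listed once
  -- (a linear ordering c is the list of the elements in increasing c-order)
  inserts : A → List A → List (List A)
  inserts x []       = (x ∷ []) ∷ []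
  inserts x (y ∷ ys) = (x ∷ y ∷ ys) ∷ map (y ∷_) (inserts x ys)

  perms : List A → List (List A)
  perms []       = [] ∷ []
  perms (x ∷ xs) = concatMap (inserts x) (perms xs)

  -- c respects o:  whenever a <_o b, a comes before b in c
  -- (equivalently, no later element of c points to an earlier one)
  respects : (A → A → Bool) → List A → Bool
  respects o []       = true
  respects o (x ∷ xs) = and (map (λ y → not (o y x)) xs) ∧ respects o xs

  module _ (_≟_ : DecidableEquality A) where

    after : A → List A → ℕ
    after α []       = 0
    after α (x ∷ xs) = if does (x ≟ α) then length xs else after α xs

    σ : Graph → (A → A → Bool) → ℕ
    σ Γ o = length (filterᵇ (λ c → respects o c) (perms (verts Γ)))

    σ-at : Graph → (A → A → Bool) → A → ℕ → ℕ
    σ-at Γ o α r =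
      length (filterᵇ (λ c → respects o c ∧ (after α c ≡ᵇ r)) (perms (verts Γ)))

    prodσ : ∀ {k} → (Fin k → Graph) → (A → A → Bool) → A → Vec ℕ k → ℕ
    prodσ Γs o α []       = 1
    prodσ Γs o α (r ∷ rs) =
      σ-at (Γs zero) (restrict o (Γs zero)) α r * prodσ (λ i → Γs (suc i)) o α rs

{-# OPTIONS --safe #-}
module Submission where

-- A linear order c of Π respects o iff each restriction c|Πᵢ respects oᵢ, because every
-- edge of Γ lies in a single block Γᵢ. Cut c at α: the part below α interleaves the parts of
-- the c|Πᵢ below α, and likewise above α, and c is recovered from its restrictions and these
-- two interleaving patterns. For two blocks U, W this is a bijection between the chambers
-- with r vertices above α, j of them in U, and quadruples (c|U, c|W, w, w′) where c|U and
-- c|W are chambers with j and r − j vertices above α and w, w′ are shuffle words; so their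
-- number is a product of two binomial coefficients. Adding the blocks one at a time, these
-- binomials assemble into the two multinomial coefficients, and summing over r gives σ(o).

open import Defs
open import Data.Nat using (ℕ; zero; suc; _+_; _*_; _∸_; _≤_; _<_; z≤n; s≤s; _≡ᵇ_; _!)
open import Data.Nat.DivMod using (_/_; m*n/n≡m; /-congˡ)
open import Data.Nat.Properties renaming (_≟_ to _≟ℕ_)
open import Data.Nat.Tactic.RingSolver using (solve-∀)
open import Data.Bool using (Bool; true; false; T; _∧_; not; if_then_else_)
open import Data.Bool.ListAction using (and; all)
open import Data.Bool.Properties using (T-∧; T-≡)
open import Data.List using (List; []; _∷_; _++_; [_]; map; filter; filterᵇ; concatMap; length; cartesianProduct)
open import Data.List.Properties using (∷-injectiveʳ; ++-assoc; length-filter; length-map; length-++; map-∘; map-id; map-cong-local; filter-++; filter-accept; filter-reject)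
open import Data.List.Membership.Propositional using (_∈_; _∉_; find; lose)
open import Data.List.Membership.Propositional.Properties using (∈-map⁺; ∈-map⁻; ∈-∃++; ∈-++⁺ˡ; ∈-++⁺ʳ; ∈-++⁻; ∈-concatMap⁺; ∈-concatMap⁻; ∈-filter⁺; ∈-filter⁻; ∈-cartesianProduct⁺; ∈-cartesianProduct⁻)
open import Data.List.Membership.Propositional.Properties.WithK using (unique∧set⇒bag)
open import Data.List.Relation.Unary.Any using (here; there)
open import Data.List.Relation.Unary.All as All using (All; []; _∷_)
open import Data.List.Relation.Unary.All.Properties using (All¬⇒¬Any; ¬Any⇒All¬; all⁺; all⁻)
open import Data.List.Relation.Unary.Unique.Propositional using (Unique; []; _∷_)
import Data.List.Relation.Unary.Unique.Propositional.Properties as Unique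
open import Data.List.Relation.Binary.Permutation.Propositional using (_↭_; prep; trans; ↭-refl; ↭-reflexive; ↭-sym; ↭⇒↭ₛ)
open import Data.List.Relation.Binary.Permutation.Propositional.Properties using (↭-length; ∈-resp-↭; shift; shifts; drop-mid; ↭-empty-inv; ++⁺; ++⁺ˡ)
import Data.List.Relation.Binary.Permutation.Setoid.Properties as ↭ₛ
open import Data.List.Relation.Binary.BagAndSetEquality using (∼bag⇒↭)
open import Data.List.Relation.Binary.Disjoint.Propositional using (Disjoint)
open import Data.Fin using (Fin; zero; suc)
open import Data.Fin.Properties as Fin using (any?)
open import Data.Vec using (Vec; []; _∷_; tabulate; zipWith)
open import Data.Vec.Relation.Binary.Pointwise.Inductive using (Pointwise; []; _∷_)
open import Data.Product using (_×_; _,_; ∃; ∃₂; proj₁; proj₂; map₁; map₂)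
open import Data.Sum using (_⊎_; inj₁; inj₂; [_,_]′)
open import Data.Empty using (⊥; ⊥-elim)
open import Function using (_∘_; mk⇔; Equivalence)
open import Function.Bundles using (_⇔_)
open import Relation.Nullary using (¬_; does; yes; no)
open import Relation.Nullary.Decidable using (dec-true; dec-false; T?)
open import Relation.Binary.Definitions using (DecidableEquality)
open import Relation.Unary using (Decidable)
open import Relation.Binary.PropositionalEquality using (_≡_; _≢_; refl; sym; cong; cong₂; subst; subst₂; setoid; module ≡-Reasoning)
  renaming (trans to ≡-trans)

private
  variable
    X Y : Set

Unique-resp-↭ : {xs ys : List X} → xs ↭ ys → Unique xs → Unique ys
Unique-resp-↭ xs↭ys = ↭ₛ.Unique-resp-↭ (setoid _) (↭⇒↭ₛ xs↭ys)

unique-set⇒↭ : {xs ys : List X} → Unique xs → Unique ys →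
               (∀ {z} → z ∈ xs → z ∈ ys) → (∀ {z} → z ∈ ys → z ∈ xs) → xs ↭ ys
unique-set⇒↭ ux uy xs⊆ys ys⊆xs = ∼bag⇒↭ (unique∧set⇒bag ux uy (mk⇔ xs⊆ys ys⊆xs))

Unique-middle⁻ : ∀ (p : List X) {x} q → Unique (p ++ x ∷ q) → x ∉ p ++ q × Unique (p ++ q)
Unique-middle⁻ p q u with Unique-resp-↭ (shift _ p q) u
... | x∉ ∷ u′ = All¬⇒¬Any x∉ , u′

Unique-middle⁺ : ∀ (p : List X) {x} q → x ∉ p ++ q → Unique (p ++ q) → Unique (p ++ x ∷ q)
Unique-middle⁺ p q x∉ u = Unique-resp-↭ (↭-sym (shift _ p q)) (¬Any⇒All¬ _ x∉ ∷ u)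

∈-middle⁻ : ∀ (p : List X) {x y} q → y ∈ p ++ x ∷ q → y ≡ x ⊎ y ∈ p ++ q
∈-middle⁻ p q y∈ with ∈-resp-↭ (shift _ p q) y∈
... | here y≡x = inj₁ y≡x
... | there y∈′ = inj₂ y∈′

∈-middle⁺ : ∀ (p : List X) {x y} q → y ≡ x ⊎ y ∈ p ++ q → y ∈ p ++ x ∷ q
∈-middle⁺ p q (inj₁ refl) = ∈-resp-↭ (↭-sym (shift _ p q)) (here refl)
∈-middle⁺ p q (inj₂ y∈)   = ∈-resp-↭ (↭-sym (shift _ p q)) (there y∈)

++-interchange-↭ : ∀ (a b c d : List X) → (a ++ b) ++ (c ++ d) ↭ (a ++ c) ++ (b ++ d)
++-interchange-↭ a b c d =
  trans (↭-reflexive (++-assoc a b (c ++ d)))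
        (trans (++⁺ˡ a (shifts b c)) (↭-reflexive (sym (++-assoc a c (b ++ d)))))

length-≡-by-inverses : (f : X → Y) (g : Y → X) {xs : List X} {ys : List Y} →
  Unique xs → Unique ys →
  (∀ {x} → x ∈ xs → f x ∈ ys) → (∀ {x} → x ∈ xs → g (f x) ≡ x) →
  (∀ {y} → y ∈ ys → g y ∈ xs) → (∀ {y} → y ∈ ys → f (g y) ≡ y) →
  length xs ≡ length ys
length-≡-by-inverses f g {xs} {ys} uxs uys f∈ gf g∈ fg =
  ≡-trans (sym (length-map f xs)) (↭-length (unique-set⇒↭ ufxs uys fxs⊆ys ys⊆fxs))
  where
    g∘f≡id : map g (map f xs) ≡ xs
    g∘f≡id = ≡-trans (sym (map-∘ xs)) (≡-trans (map-cong-local (All.tabulate gf)) (map-id xs))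
    ufxs : Unique (map f xs)
    ufxs = Unique.map⁻ (subst Unique (sym g∘f≡id) uxs)
    fxs⊆ys : ∀ {y} → y ∈ map f xs → y ∈ ys
    fxs⊆ys y∈ with ∈-map⁻ f y∈
    ... | x , x∈ , refl = f∈ x∈
    ys⊆fxs : ∀ {y} → y ∈ ys → y ∈ map f xs
    ys⊆fxs y∈ = subst (_∈ map f xs) (fg y∈) (∈-map⁺ f (g∈ y∈))

module Arrangements {A : Set} (_≟_ : DecidableEquality A) where

  below above : A → List A → List A
  below α []       = []
  below α (x ∷ xs) = if does (x ≟ α) then [] else x ∷ below α xs
  above α []       = []
  above α (x ∷ xs) = if does (x ≟ α) then xs else above α xs

  after≡length-above : ∀ α c → after _≟_ α c ≡ length (above α c)
  after≡length-above α []       = refl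
  after≡length-above α (x ∷ xs) with does (x ≟ α)
  ... | true  = refl
  ... | false = after≡length-above α xs

  below-middle : ∀ {α} p q → α ∉ p → below α (p ++ α ∷ q) ≡ p
  below-middle {α} []      q α∉ rewrite dec-true (α ≟ α) refl = refl
  below-middle {α} (x ∷ p) q α∉ rewrite dec-false (x ≟ α) (α∉ ∘ here ∘ sym) =
    cong (x ∷_) (below-middle p q (α∉ ∘ there))

  above-middle : ∀ {α} p q → α ∉ p → above α (p ++ α ∷ q) ≡ q
  above-middle {α} []      q α∉ rewrite dec-true (α ≟ α) refl = refl
  above-middle {α} (x ∷ p) q α∉ rewrite dec-false (x ≟ α) (α∉ ∘ here ∘ sym) =
    above-middle p q (α∉ ∘ there)

  after-middle : ∀ {α} p q → α ∉ p → after _≟_ α (p ++ α ∷ q) ≡ length q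
  after-middle p q α∉ = ≡-trans (after≡length-above _ (p ++ _ ∷ q)) (cong length (above-middle p q α∉))

  ∈-inserts⁻ : ∀ (x : A) l {c} → c ∈ inserts x l → ∃₂ λ p q → c ≡ p ++ x ∷ q × l ≡ p ++ q
  ∈-inserts⁻ x []       (here refl) = [] , [] , refl , refl
  ∈-inserts⁻ x (y ∷ ys) (here refl) = [] , y ∷ ys , refl , refl
  ∈-inserts⁻ x (y ∷ ys) (there c∈) with ∈-map⁻ (y ∷_) c∈
  ... | c′ , c′∈ , refl with ∈-inserts⁻ x ys c′∈
  ... | p , q , refl , refl = y ∷ p , q , refl , refl

  ∈-inserts⁺ : ∀ (x : A) p q → p ++ x ∷ q ∈ inserts x (p ++ q)
  ∈-inserts⁺ x []      []      = here refl
  ∈-inserts⁺ x []      (y ∷ q) = here refl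
  ∈-inserts⁺ x (y ∷ p) q       = there (∈-map⁺ (y ∷_) (∈-inserts⁺ x p q))

  ∈-perms⁻ : ∀ V {c : List A} → c ∈ perms V → c ↭ V
  ∈-perms⁻ []       (here refl) = ↭-refl
  ∈-perms⁻ (x ∷ xs) c∈ with find (∈-concatMap⁻ (inserts x) {xs = perms xs} c∈)
  ... | l , l∈ , c∈l with ∈-inserts⁻ x l c∈l
  ... | p , q , refl , refl = trans (shift x p q) (prep x (∈-perms⁻ xs l∈))

  ∈-perms⁺ : ∀ V {c : List A} → c ↭ V → c ∈ perms V
  ∈-perms⁺ []       c↭ rewrite ↭-empty-inv c↭ = here refl
  ∈-perms⁺ (x ∷ xs) c↭ with ∈-∃++ (∈-resp-↭ (↭-sym c↭) (here refl))
  ... | p , q , refl = ∈-concatMap⁺ (inserts x) {xs = perms xs}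
                         (lose (∈-perms⁺ xs (drop-mid p [] c↭)) (∈-inserts⁺ x p q))

  inserts-recover : ∀ {x : A} {l c} → x ∉ l → c ∈ inserts x l → l ≡ below x c ++ above x c
  inserts-recover {x} x∉ c∈ with ∈-inserts⁻ x _ c∈
  ... | p , q , refl , refl =
    sym (cong₂ _++_ (below-middle p q (x∉ ∘ ∈-++⁺ˡ)) (above-middle p q (x∉ ∘ ∈-++⁺ˡ)))

  inserts-unique : ∀ (x : A) l → x ∉ l → Unique (inserts x l)
  inserts-unique x []       x∉ = [] ∷ []
  inserts-unique x (y ∷ ys) x∉ =
    All.tabulate head≢ ∷ Unique.map⁺ ∷-injectiveʳ (inserts-unique x ys (x∉ ∘ there))
    where
      head≢ : ∀ {c} → c ∈ map (y ∷_) (inserts x ys) → x ∷ y ∷ ys ≢ c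
      head≢ c∈ refl with ∈-map⁻ (y ∷_) c∈
      ... | _ , _ , refl = x∉ (here refl)

  perms-unique : ∀ (V : List A) → Unique V → Unique (perms V)
  perms-unique []       _           = [] ∷ []
  perms-unique (x ∷ xs) (x∉ ∷ uxs) = concatMap-unique (perms xs) (perms-unique xs uxs) (λ l∈ → l∈)
    where
      x∉perm : ∀ {l} → l ∈ perms xs → x ∉ l
      x∉perm l∈ x∈l = All¬⇒¬Any x∉ (∈-resp-↭ (∈-perms⁻ xs l∈) x∈l)
      concatMap-unique : ∀ L → Unique L → (∀ {l} → l ∈ L → l ∈ perms xs) → Unique (concatMap (inserts x) L)
      concatMap-unique []      _          _       = []
      concatMap-unique (l ∷ L) (l∉ ∷ uL) ⊆perms =
        Unique.++⁺ (inserts-unique x l (x∉perm (⊆perms (here refl))))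
                   (concatMap-unique L uL (⊆perms ∘ there)) disjoint
        where
          disjoint : Disjoint (inserts x l) (concatMap (inserts x) L)
          disjoint (c∈l , c∈L) with find (∈-concatMap⁻ (inserts x) {xs = L} c∈L)
          ... | l′ , l′∈ , c∈l′ = All¬⇒¬Any l∉ (subst (_∈ L) l′≡l l′∈)
            where
              l′≡l : l′ ≡ l
              l′≡l = ≡-trans (inserts-recover (x∉perm (⊆perms (there l′∈))) c∈l′)
                             (sym (inserts-recover (x∉perm (⊆perms (here refl))) c∈l))

sumUpTo-cong : ∀ n {f g : ℕ → ℕ} → (∀ j → j ≤ n → f j ≡ g j) → sumUpTo n f ≡ sumUpTo n g
sumUpTo-cong zero    f≡g = f≡g 0 z≤n
sumUpTo-cong (suc n) f≡g = cong₂ _+_ (sumUpTo-cong n (λ j j≤n → f≡g j (m≤n⇒m≤1+n j≤n))) (f≡g (suc n) ≤-refl)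

sumUpTo-zero : ∀ n {f : ℕ → ℕ} → (∀ j → j ≤ n → f j ≡ 0) → sumUpTo n f ≡ 0
sumUpTo-zero zero    f≡0 = f≡0 0 z≤n
sumUpTo-zero (suc n) f≡0 = cong₂ _+_ (sumUpTo-zero n (λ j j≤n → f≡0 j (m≤n⇒m≤1+n j≤n))) (f≡0 (suc n) ≤-refl)

sumUpTo-+ : ∀ n (f g : ℕ → ℕ) → sumUpTo n (λ j → f j + g j) ≡ sumUpTo n f + sumUpTo n g
sumUpTo-+ zero    f g = refl
sumUpTo-+ (suc n) f g = begin
  sumUpTo n (λ j → f j + g j) + (f (suc n) + g (suc n))  ≡⟨ cong (_+ (f (suc n) + g (suc n))) (sumUpTo-+ n f g) ⟩
  sumUpTo n f + sumUpTo n g + (f (suc n) + g (suc n))    ≡⟨ +-assoc-middle (sumUpTo n f) (sumUpTo n g) (f (suc n)) (g (suc n)) ⟩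
  sumUpTo n f + f (suc n) + (sumUpTo n g + g (suc n))    ∎
  where
    open ≡-Reasoning
    +-assoc-middle : ∀ a b c d → a + b + (c + d) ≡ a + c + (b + d)
    +-assoc-middle = solve-∀

sumUpTo-*ˡ : ∀ n a (f : ℕ → ℕ) → sumUpTo n (λ j → a * f j) ≡ a * sumUpTo n f
sumUpTo-*ˡ zero    a f = refl
sumUpTo-*ˡ (suc n) a f = ≡-trans (cong (_+ a * f (suc n)) (sumUpTo-*ˡ n a f))
                                 (sym (*-distribˡ-+ a (sumUpTo n f) (f (suc n))))

indicator-≢ : ∀ {m j} → m ≢ j → (if m ≡ᵇ j then 1 else 0) ≡ 0
indicator-≢ {m} {j} m≢j rewrite dec-false (m ≟ℕ j) m≢j = refl

sumUpTo-indicator : ∀ n m → m ≤ n → sumUpTo n (λ j → if m ≡ᵇ j then 1 else 0) ≡ 1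
sumUpTo-indicator zero    zero    _   = refl
sumUpTo-indicator (suc n) m       m≤1+n with m ≤? n
... | yes m≤n = cong₂ _+_ (sumUpTo-indicator n m m≤n) (indicator-≢ (<⇒≢ (s≤s m≤n)))
... | no  m≰n rewrite ≤-antisym m≤1+n (≰⇒> m≰n) | dec-true (n ≟ℕ n) refl =
  cong (_+ 1) (sumUpTo-zero n (λ j j≤n → indicator-≢ (λ 1+n≡j → <⇒≱ (n<1+n n) (subst (_≤ n) (sym 1+n≡j) j≤n))))

sumUpTo-triangle : ∀ M (h : ℕ → ℕ → ℕ) →
  sumUpTo M (λ s → sumUpTo s (λ j → h j (s ∸ j))) ≡ sumUpTo M (λ j → sumUpTo (M ∸ j) (h j))
sumUpTo-triangle zero    h = refl
sumUpTo-triangle (suc M) h = begin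
    sumUpTo M (λ s → sumUpTo s (λ j → h j (s ∸ j))) + (sumUpTo M (λ j → h j (suc M ∸ j)) + h (suc M) (M ∸ M))
  ≡⟨ cong₂ (λ a b → a + (b + h (suc M) (M ∸ M))) (sumUpTo-triangle M h) (sumUpTo-cong M (λ j j≤M → cong (h j) (+-∸-assoc 1 j≤M))) ⟩
    sumUpTo M (λ j → sumUpTo (M ∸ j) (h j)) + (sumUpTo M (λ j → h j (suc (M ∸ j))) + h (suc M) (M ∸ M))
  ≡⟨ sym (+-assoc (sumUpTo M (λ j → sumUpTo (M ∸ j) (h j))) _ _) ⟩
    sumUpTo M (λ j → sumUpTo (M ∸ j) (h j)) + sumUpTo M (λ j → h j (suc (M ∸ j))) + h (suc M) (M ∸ M)
  ≡⟨ cong (_+ h (suc M) (M ∸ M)) (sym (sumUpTo-+ M (λ j → sumUpTo (M ∸ j) (h j)) (λ j → h j (suc (M ∸ j))))) ⟩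
    sumUpTo M (λ j → sumUpTo (M ∸ j) (h j) + h j (suc (M ∸ j))) + h (suc M) (M ∸ M)
  ≡⟨ cong₂ _+_ (sumUpTo-cong M (λ j j≤M → cong (λ t → sumUpTo t (h j)) (sym (+-∸-assoc 1 j≤M))))
               (≡-trans (cong (h (suc M)) (n∸n≡0 M)) (cong (λ t → sumUpTo t (h (suc M))) (sym (n∸n≡0 M)))) ⟩
    sumUpTo M (λ j → sumUpTo (suc M ∸ j) (h j)) + sumUpTo (M ∸ M) (h (suc M)) ∎
  where open ≡-Reasoning

sumUpTo-truncate : ∀ N M (f : ℕ → ℕ) → N ≤ M → (∀ j → N < j → j ≤ M → f j ≡ 0) → sumUpTo M f ≡ sumUpTo N f
sumUpTo-truncate N zero    f z≤n _ = refl
sumUpTo-truncate N (suc M) f N≤1+M f≡0 with m≤n⇒m<n∨m≡n N≤1+M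
... | inj₂ refl      = refl
... | inj₁ (s≤s N≤M) =
  ≡-trans (cong₂ _+_ (sumUpTo-truncate N M f N≤M (λ j N<j j≤M → f≡0 j N<j (m≤n⇒m≤1+n j≤M))) (f≡0 (suc M) (s≤s N≤M) ≤-refl))
          (+-identityʳ _)

sumComp-cong : ∀ k s (f g : Vec ℕ k → ℕ) → (∀ v → vsum v ≡ s → f v ≡ g v) → sumComp k s f ≡ sumComp k s g
sumComp-cong zero    zero    f g f≡g = f≡g [] refl
sumComp-cong zero    (suc s) f g f≡g = refl
sumComp-cong (suc k) s       f g f≡g = sumUpTo-cong s (λ j j≤s →
  sumComp-cong k (s ∸ j) _ _ (λ v Σv≡s∸j → f≡g (j ∷ v) (≡-trans (cong (j +_) Σv≡s∸j) (m+[n∸m]≡n j≤s))))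

sumComp-*ˡ : ∀ k s a (f : Vec ℕ k → ℕ) → sumComp k s (λ v → a * f v) ≡ a * sumComp k s f
sumComp-*ˡ zero    zero    a f = refl
sumComp-*ˡ zero    (suc s) a f = sym (*-zeroʳ a)
sumComp-*ˡ (suc k) s       a f = ≡-trans (sumUpTo-cong s (λ j _ → sumComp-*ˡ k (s ∸ j) a _)) (sumUpTo-*ˡ s a _)

sumComp-zero : ∀ k s → sumComp k s (λ _ → 0) ≡ 0
sumComp-zero zero    zero    = refl
sumComp-zero zero    (suc s) = refl
sumComp-zero (suc k) s       = sumUpTo-zero s (λ j _ → sumComp-zero k (s ∸ j))

sumComp-one : ∀ r (f : Vec ℕ 1 → ℕ) → sumComp 1 r f ≡ f (r ∷ [])
sumComp-one zero    f = refl
sumComp-one (suc r) f = cong₂ _+_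
  (sumUpTo-zero r (λ j j≤r → cong (λ t → sumComp 0 t (λ v → f (j ∷ v))) (+-∸-assoc 1 j≤r)))
  (cong (λ t → sumComp 0 t (λ v → f (suc r ∷ v))) (n∸n≡0 r))

OutsideBox : ∀ {k} → ℕ → Vec ℕ k → Set
OutsideBox N []       = ⊥
OutsideBox N (x ∷ xs) = N < x ⊎ OutsideBox N xs

sumComp-outside-box : ∀ k N t (f : Vec ℕ k → ℕ) → (∀ v → OutsideBox N v → f v ≡ 0) → k * N < t → sumComp k t f ≡ 0
sumComp-outside-box zero    N (suc t) f f≡0 kN<t = refl
sumComp-outside-box (suc k) N t       f f≡0 kN<t = sumUpTo-zero t summand≡0
  where
    summand≡0 : ∀ j → j ≤ t → sumComp k (t ∸ j) (λ v → f (j ∷ v)) ≡ 0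
    summand≡0 j j≤t with N <? j
    ... | yes N<j = ≡-trans (sumComp-cong k (t ∸ j) _ _ (λ v _ → f≡0 (j ∷ v) (inj₁ N<j))) (sumComp-zero k (t ∸ j))
    ... | no  N≮j = sumComp-outside-box k N (t ∸ j) (λ v → f (j ∷ v)) (λ v out → f≡0 (j ∷ v) (inj₂ out))
                      (+-cancelˡ-< j _ _ (subst (j + k * N <_) (sym (m+[n∸m]≡n j≤t))
                        (≤-<-trans (+-monoˡ-≤ (k * N) (≮⇒≥ N≮j)) kN<t)))

sumBox≡sumUpTo-sumComp : ∀ k N (f : Vec ℕ k → ℕ) → (∀ v → OutsideBox N v → f v ≡ 0) →
  sumUpTo (k * N) (λ s → sumComp k s f) ≡ sumBox k N f
sumBox≡sumUpTo-sumComp zero    N f f≡0 = refl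
sumBox≡sumUpTo-sumComp (suc k) N f f≡0 = begin
    sumUpTo M (λ s → sumUpTo s (λ j → sumComp k (s ∸ j) (λ v → f (j ∷ v))))
  ≡⟨ sumUpTo-triangle M (λ j t → sumComp k t (λ v → f (j ∷ v))) ⟩
    sumUpTo M (λ j → sumUpTo (M ∸ j) (λ t → sumComp k t (λ v → f (j ∷ v))))
  ≡⟨ sumUpTo-truncate N M _ (m≤m+n N (k * N)) (λ j N<j _ → sumUpTo-zero (M ∸ j) (λ t _ →
       ≡-trans (sumComp-cong k t _ _ (λ v _ → f≡0 (j ∷ v) (inj₁ N<j))) (sumComp-zero k t))) ⟩
    sumUpTo N (λ j → sumUpTo (M ∸ j) (λ t → sumComp k t (λ v → f (j ∷ v))))
  ≡⟨ sumUpTo-cong N (λ j j≤N → ≡-trans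
       (sumUpTo-truncate (k * N) (M ∸ j) _ (kN≤M∸j j≤N)
         (λ t kN<t _ → sumComp-outside-box k N t (λ v → f (j ∷ v)) (λ v out → f≡0 (j ∷ v) (inj₂ out)) kN<t))
       (sumBox≡sumUpTo-sumComp k N (λ v → f (j ∷ v)) (λ v out → f≡0 (j ∷ v) (inj₂ out)))) ⟩
    sumUpTo N (λ j → sumBox k N (λ v → f (j ∷ v))) ∎
  where
    open ≡-Reasoning
    M = N + k * N
    kN≤M∸j : ∀ {j} → j ≤ N → k * N ≤ M ∸ j
    kN≤M∸j {j} j≤N = subst (_≤ M ∸ j) (m+n∸m≡n j (k * N)) (∸-monoˡ-≤ j (+-monoˡ-≤ (k * N) j≤N))

length-filterᵇ-∷ : ∀ (p : X → Bool) x L → length (filterᵇ p (x ∷ L)) ≡ (if p x then 1 else 0) + length (filterᵇ p L)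
length-filterᵇ-∷ p x L with p x
... | true  = refl
... | false = refl

length-filterᵇ-by-value : ∀ (p : X → Bool) (g : X → ℕ) n L → (∀ {x} → x ∈ L → T (p x) → g x ≤ n) →
  length (filterᵇ p L) ≡ sumUpTo n (λ j → length (filterᵇ (λ x → p x ∧ (g x ≡ᵇ j)) L))
length-filterᵇ-by-value p g n []      _   = sym (sumUpTo-zero n (λ _ _ → refl))
length-filterᵇ-by-value p g n (x ∷ L) g≤n = begin
    length (filterᵇ p (x ∷ L))
  ≡⟨ length-filterᵇ-∷ p x L ⟩
    (if p x then 1 else 0) + length (filterᵇ p L)
  ≡⟨ cong₂ _+_ (head-count (p x) refl) (length-filterᵇ-by-value p g n L (g≤n ∘ there)) ⟩
    sumUpTo n (λ j → if p x ∧ (g x ≡ᵇ j) then 1 else 0) + sumUpTo n (λ j → length (filterᵇ (λ y → p y ∧ (g y ≡ᵇ j)) L))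
  ≡⟨ sym (sumUpTo-+ n _ _) ⟩
    sumUpTo n (λ j → (if p x ∧ (g x ≡ᵇ j) then 1 else 0) + length (filterᵇ (λ y → p y ∧ (g y ≡ᵇ j)) L))
  ≡⟨ sumUpTo-cong n (λ j _ → sym (length-filterᵇ-∷ (λ y → p y ∧ (g y ≡ᵇ j)) x L)) ⟩
    sumUpTo n (λ j → length (filterᵇ (λ y → p y ∧ (g y ≡ᵇ j)) (x ∷ L))) ∎
  where
    open ≡-Reasoning
    head-count : ∀ b → p x ≡ b → (if b then 1 else 0) ≡ sumUpTo n (λ j → if p x ∧ (g x ≡ᵇ j) then 1 else 0)
    head-count true  px rewrite px = sym (sumUpTo-indicator n (g x) (g≤n (here refl) (Equivalence.from T-≡ px)))
    head-count false px rewrite px = sym (sumUpTo-zero n (λ _ _ → refl))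

filterᵇ-cong-local : ∀ (p q : X → Bool) L → (∀ {x} → x ∈ L → p x ≡ q x) → filterᵇ p L ≡ filterᵇ q L
filterᵇ-cong-local p q []      _   = refl
filterᵇ-cong-local p q (x ∷ L) p≡q with p x | q x | p≡q (here refl)
... | true  | true  | _ = cong (x ∷_) (filterᵇ-cong-local p q L (p≡q ∘ there))
... | false | false | _ = filterᵇ-cong-local p q L (p≡q ∘ there)

length-cartesianProduct : ∀ (xs : List X) (ys : List Y) → length (cartesianProduct xs ys) ≡ length xs * length ys
length-cartesianProduct []       ys = refl
length-cartesianProduct (x ∷ xs) ys =
  ≡-trans (length-++ (map (x ,_) ys)) (cong₂ _+_ (length-map (x ,_) ys) (length-cartesianProduct xs ys))

-- Shuffle words and multinomial coefficients

#trues #falses : List Bool → ℕ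
#trues []          = 0
#trues (true ∷ w)  = suc (#trues w)
#trues (false ∷ w) = #trues w
#falses []          = 0
#falses (true ∷ w)  = #falses w
#falses (false ∷ w) = suc (#falses w)

shuffles : ℕ → ℕ → List (List Bool)
shuffles zero    zero    = [ [] ]
shuffles zero    (suc b) = map (false ∷_) (shuffles zero b)
shuffles (suc a) zero    = map (true ∷_) (shuffles a zero)
shuffles (suc a) (suc b) = map (true ∷_) (shuffles a (suc b)) ++ map (false ∷_) (shuffles (suc a) b)

shuffles-unique : ∀ a b → Unique (shuffles a b)
shuffles-unique zero    zero    = [] ∷ []
shuffles-unique zero    (suc b) = Unique.map⁺ ∷-injectiveʳ (shuffles-unique zero b)
shuffles-unique (suc a) zero    = Unique.map⁺ ∷-injectiveʳ (shuffles-unique a zero)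
shuffles-unique (suc a) (suc b) =
  Unique.++⁺ (Unique.map⁺ ∷-injectiveʳ (shuffles-unique a (suc b)))
             (Unique.map⁺ ∷-injectiveʳ (shuffles-unique (suc a) b))
             (λ (w∈t , w∈f) → heads-differ (∈-map⁻ (true ∷_) w∈t) (∈-map⁻ (false ∷_) w∈f))
  where
    heads-differ : ∀ {w : List Bool} {L L′} → ∃ (λ u → u ∈ L × w ≡ true ∷ u) → ∃ (λ u → u ∈ L′ × w ≡ false ∷ u) → ⊥
    heads-differ (_ , _ , refl) (_ , _ , ())

∈-shuffles⁻ : ∀ a b {w} → w ∈ shuffles a b → #trues w ≡ a × #falses w ≡ b
∈-shuffles⁻ zero    zero    (here refl) = refl , refl
∈-shuffles⁻ zero    (suc b) w∈ with ∈-map⁻ (false ∷_) w∈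
... | w′ , w′∈ , refl = map₂ (cong suc) (∈-shuffles⁻ zero b w′∈)
∈-shuffles⁻ (suc a) zero    w∈ with ∈-map⁻ (true ∷_) w∈
... | w′ , w′∈ , refl = map₁ (cong suc) (∈-shuffles⁻ a zero w′∈)
∈-shuffles⁻ (suc a) (suc b) w∈ with ∈-++⁻ (map (true ∷_) (shuffles a (suc b))) w∈
... | inj₁ w∈t with ∈-map⁻ (true ∷_) w∈t
...   | w′ , w′∈ , refl = map₁ (cong suc) (∈-shuffles⁻ a (suc b) w′∈)
∈-shuffles⁻ (suc a) (suc b) w∈ | inj₂ w∈f with ∈-map⁻ (false ∷_) w∈f
...   | w′ , w′∈ , refl = map₂ (cong suc) (∈-shuffles⁻ (suc a) b w′∈)

∈-shuffles⁺ : ∀ w → w ∈ shuffles (#trues w) (#falses w)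
∈-shuffles⁺ []          = here refl
∈-shuffles⁺ (true ∷ w)  with #trues w | #falses w | ∈-shuffles⁺ w
... | a | zero  | w∈ = ∈-map⁺ (true ∷_) w∈
... | a | suc b | w∈ = ∈-++⁺ˡ (∈-map⁺ (true ∷_) w∈)
∈-shuffles⁺ (false ∷ w) with #trues w | #falses w | ∈-shuffles⁺ w
... | zero  | b | w∈ = ∈-map⁺ (false ∷_) w∈
... | suc a | b | w∈ = ∈-++⁺ʳ (map (true ∷_) (shuffles a (suc b))) (∈-map⁺ (false ∷_) w∈)

#shuffles : ℕ → ℕ → ℕ
#shuffles a b = length (shuffles a b)

#shuffles-zeroˡ : ∀ b → #shuffles 0 b ≡ 1
#shuffles-zeroˡ zero    = refl
#shuffles-zeroˡ (suc b) = ≡-trans (length-map (false ∷_) (shuffles 0 b)) (#shuffles-zeroˡ b)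

#shuffles-zeroʳ : ∀ a → #shuffles a 0 ≡ 1
#shuffles-zeroʳ zero    = refl
#shuffles-zeroʳ (suc a) = ≡-trans (length-map (true ∷_) (shuffles a 0)) (#shuffles-zeroʳ a)

#shuffles-suc : ∀ a b → #shuffles (suc a) (suc b) ≡ #shuffles a (suc b) + #shuffles (suc a) b
#shuffles-suc a b = ≡-trans (length-++ (map (true ∷_) (shuffles a (suc b))))
  (cong₂ _+_ (length-map (true ∷_) (shuffles a (suc b))) (length-map (false ∷_) (shuffles (suc a) b)))

#shuffles*a!*b!≡[a+b]! : ∀ a b → #shuffles a b * (a ! * b !) ≡ (a + b) !
#shuffles*a!*b!≡[a+b]! zero    b rewrite #shuffles-zeroˡ b = ≡-trans (+-identityʳ (b ! + 0)) (+-identityʳ (b !))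
#shuffles*a!*b!≡[a+b]! (suc a) zero rewrite #shuffles-zeroʳ (suc a) | +-identityʳ a = ≡-trans (+-identityʳ _) (*-identityʳ _)
#shuffles*a!*b!≡[a+b]! (suc a) (suc b) rewrite #shuffles-suc a b = begin
    (#shuffles a (suc b) + #shuffles (suc a) b) * (suc a ! * suc b !)
  ≡⟨ distribute (#shuffles a (suc b)) (#shuffles (suc a) b) a b (a !) (b !) ⟩
    suc a * (#shuffles a (suc b) * (a ! * suc b !)) + suc b * (#shuffles (suc a) b * (suc a ! * b !))
  ≡⟨ cong₂ (λ x y → suc a * x + suc b * y) (#shuffles*a!*b!≡[a+b]! a (suc b)) (#shuffles*a!*b!≡[a+b]! (suc a) b) ⟩
    suc a * (a + suc b) ! + suc b * (suc a + b) !
  ≡⟨ cong (λ t → suc a * t ! + suc b * (suc a + b) !) (+-suc a b) ⟩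
    suc a * (suc (a + b)) ! + suc b * (suc (a + b)) !
  ≡⟨ collect a b ((suc (a + b)) !) ⟩
    suc (suc (a + b)) * (suc (a + b)) !
  ≡⟨ cong (λ t → (suc t) !) (sym (+-suc a b)) ⟩
    (suc a + suc b) ! ∎
  where
    open ≡-Reasoning
    distribute : ∀ x y a b fa fb → (x + y) * ((suc a * fa) * (suc b * fb)) ≡
                                   suc a * (x * (fa * (suc b * fb))) + suc b * (y * ((suc a * fa) * fb))
    distribute = solve-∀
    collect : ∀ a b X → suc a * X + suc b * X ≡ suc (suc (a + b)) * X
    collect = solve-∀

-- Proved together with the factorial identity below, which makes the division exact.
multinomial-∷ : ∀ {k} a (v : Vec ℕ k) → multinomial (a ∷ v) ≡ #shuffles a (vsum v) * multinomial v
multinomial*prodFact≡vsum! : ∀ {k} (v : Vec ℕ k) → multinomial v * prodFact v ≡ vsum v !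

multinomial-∷ a v = begin
    ((a + vsum v) ! / (a ! * prodFact v)) {{prodFact≢0 (a ∷ v)}}
  ≡⟨ /-congˡ {{prodFact≢0 (a ∷ v)}} numerator ⟩
    ((#shuffles a (vsum v) * multinomial v) * (a ! * prodFact v) / (a ! * prodFact v)) {{prodFact≢0 (a ∷ v)}}
  ≡⟨ m*n/n≡m (#shuffles a (vsum v) * multinomial v) (a ! * prodFact v) {{prodFact≢0 (a ∷ v)}} ⟩
    #shuffles a (vsum v) * multinomial v ∎
  where
    open ≡-Reasoning
    regroup : ∀ B fa M P → B * (fa * (M * P)) ≡ (B * M) * (fa * P)
    regroup = solve-∀
    numerator : (a + vsum v) ! ≡ (#shuffles a (vsum v) * multinomial v) * (a ! * prodFact v)
    numerator = begin
      (a + vsum v) !                                             ≡⟨ #shuffles*a!*b!≡[a+b]! a (vsum v) ⟨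
      #shuffles a (vsum v) * (a ! * vsum v !)                    ≡⟨ cong (λ t → #shuffles a (vsum v) * (a ! * t)) (multinomial*prodFact≡vsum! v) ⟨
      #shuffles a (vsum v) * (a ! * (multinomial v * prodFact v)) ≡⟨ regroup (#shuffles a (vsum v)) (a !) (multinomial v) (prodFact v) ⟩
      (#shuffles a (vsum v) * multinomial v) * (a ! * prodFact v) ∎

multinomial*prodFact≡vsum! []      = refl
multinomial*prodFact≡vsum! (a ∷ v) = begin
    multinomial (a ∷ v) * (a ! * prodFact v)
  ≡⟨ cong (_* (a ! * prodFact v)) (multinomial-∷ a v) ⟩
    #shuffles a (vsum v) * multinomial v * (a ! * prodFact v)
  ≡⟨ regroup (#shuffles a (vsum v)) (multinomial v) (a !) (prodFact v) ⟩
    #shuffles a (vsum v) * (a ! * (multinomial v * prodFact v))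
  ≡⟨ cong (λ t → #shuffles a (vsum v) * (a ! * t)) (multinomial*prodFact≡vsum! v) ⟩
    #shuffles a (vsum v) * (a ! * vsum v !)
  ≡⟨ #shuffles*a!*b!≡[a+b]! a (vsum v) ⟩
    (a + vsum v) ! ∎
  where
    open ≡-Reasoning
    regroup : ∀ B M fa P → B * M * (fa * P) ≡ B * (fa * (M * P))
    regroup = solve-∀

multinomial-[_] : ∀ x → multinomial (x ∷ []) ≡ 1
multinomial-[ x ] = ≡-trans (multinomial-∷ x []) (cong (_* 1) (#shuffles-zeroʳ x))

interleave : List Bool → List X → List X → List X
interleave []          _        _        = []
interleave (true ∷ w)  (x ∷ xs) ys       = x ∷ interleave w xs ys
interleave (true ∷ w)  []       ys       = []
interleave (false ∷ w) xs       (y ∷ ys) = y ∷ interleave w xs ys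
interleave (false ∷ w) xs       []       = []

interleave-↭ : ∀ w (xs ys : List X) → #trues w ≡ length xs → #falses w ≡ length ys → interleave w xs ys ↭ xs ++ ys
interleave-↭ []          []       []       _  _  = ↭-refl
interleave-↭ (true ∷ w)  (x ∷ xs) ys       t≡ f≡ = prep x (interleave-↭ w xs ys (suc-injective t≡) f≡)
interleave-↭ (false ∷ w) xs       (y ∷ ys) t≡ f≡ =
  trans (prep y (interleave-↭ w xs ys t≡ (suc-injective f≡))) (↭-sym (shift y xs ys))

module _ {P : X → Set} (P? : Decidable P) where

  filter-interleaveˡ : ∀ w xs ys → #trues w ≡ length xs → #falses w ≡ length ys →
    All P xs → All (¬_ ∘ P) ys → filter P? (interleave w xs ys) ≡ xs
  filter-interleaveˡ []          []       []       _  _  _           _           = refl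
  filter-interleaveˡ (true ∷ w)  (x ∷ xs) ys       t≡ f≡ (px ∷ pxs)  ¬pys        =
    ≡-trans (filter-accept P? px) (cong (x ∷_) (filter-interleaveˡ w xs ys (suc-injective t≡) f≡ pxs ¬pys))
  filter-interleaveˡ (false ∷ w) xs       (y ∷ ys) t≡ f≡ pxs         (¬py ∷ ¬pys) =
    ≡-trans (filter-reject P? ¬py) (filter-interleaveˡ w xs ys t≡ (suc-injective f≡) pxs ¬pys)

  filter-interleaveʳ : ∀ w xs ys → #trues w ≡ length xs → #falses w ≡ length ys →
    All (¬_ ∘ P) xs → All P ys → filter P? (interleave w xs ys) ≡ ys
  filter-interleaveʳ []          []       []       _  _  _            _          = refl
  filter-interleaveʳ (true ∷ w)  (x ∷ xs) ys       t≡ f≡ (¬px ∷ ¬pxs) pys        =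
    ≡-trans (filter-reject P? ¬px) (filter-interleaveʳ w xs ys (suc-injective t≡) f≡ ¬pxs pys)
  filter-interleaveʳ (false ∷ w) xs       (y ∷ ys) t≡ f≡ ¬pxs         (py ∷ pys) =
    ≡-trans (filter-accept P? py) (cong (y ∷_) (filter-interleaveʳ w xs ys t≡ (suc-injective f≡) ¬pxs pys))

  map-interleave : ∀ w xs ys → #trues w ≡ length xs → #falses w ≡ length ys →
    All P xs → All (¬_ ∘ P) ys → map (does ∘ P?) (interleave w xs ys) ≡ w
  map-interleave []          []       []       _  _  _           _            = refl
  map-interleave (true ∷ w)  (x ∷ xs) ys       t≡ f≡ (px ∷ pxs)  ¬pys         =
    cong₂ _∷_ (dec-true (P? x) px) (map-interleave w xs ys (suc-injective t≡) f≡ pxs ¬pys)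
  map-interleave (false ∷ w) xs       (y ∷ ys) t≡ f≡ pxs         (¬py ∷ ¬pys) =
    cong₂ _∷_ (dec-false (P? y) ¬py) (map-interleave w xs ys t≡ (suc-injective f≡) pxs ¬pys)

  #trues-map : ∀ l → #trues (map (does ∘ P?) l) ≡ length (filter P? l)
  #trues-map []      = refl
  #trues-map (x ∷ l) with does (P? x)
  ... | true  = cong suc (#trues-map l)
  ... | false = #trues-map l

  -- P and Q need only be complementary on l: in the gluing step they are membership
  -- in two blocks, which share α.
  module _ {Q : X → Set} (Q? : Decidable Q) where

    #falses-map : ∀ l → (∀ {x} → x ∈ l → does (Q? x) ≡ not (does (P? x))) →
      #falses (map (does ∘ P?) l) ≡ length (filter Q? l)
    #falses-map []      _    = refl
    #falses-map (x ∷ l) Q≡¬P with does (P? x) | does (Q? x) | Q≡¬P (here refl)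
    ... | true  | false | _ = #falses-map l (Q≡¬P ∘ there)
    ... | false | true  | _ = cong suc (#falses-map l (Q≡¬P ∘ there))

    interleave-split : ∀ l → (∀ {x} → x ∈ l → does (Q? x) ≡ not (does (P? x))) →
      interleave (map (does ∘ P?) l) (filter P? l) (filter Q? l) ≡ l
    interleave-split []      _    = refl
    interleave-split (x ∷ l) Q≡¬P with does (P? x) | does (Q? x) | Q≡¬P (here refl)
    ... | true  | false | _ = cong (x ∷_) (interleave-split l (Q≡¬P ∘ there))
    ... | false | true  | _ = cong (x ∷_) (interleave-split l (Q≡¬P ∘ there))

    length-filter-split : ∀ l → (∀ {x} → x ∈ l → does (Q? x) ≡ not (does (P? x))) →
      length l ≡ length (filter P? l) + length (filter Q? l)
    length-filter-split l Q≡¬P = begin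
      length l                                                          ≡⟨ cong length (interleave-split l Q≡¬P) ⟨
      length (interleave (map (does ∘ P?) l) (filter P? l) (filter Q? l)) ≡⟨ ↭-length (interleave-↭ (map (does ∘ P?) l) (filter P? l) (filter Q? l) (#trues-map l) (#falses-map l Q≡¬P)) ⟩
      length (filter P? l ++ filter Q? l)                               ≡⟨ length-++ (filter P? l) ⟩
      length (filter P? l) + length (filter Q? l)                       ∎
      where open ≡-Reasoning

    map-does-∈-shuffles : ∀ l → (∀ {x} → x ∈ l → does (Q? x) ≡ not (does (P? x))) →
      map (does ∘ P?) l ∈ shuffles (length (filter P? l)) (length (filter Q? l))
    map-does-∈-shuffles l Q≡¬P =
      subst₂ (λ a b → map (does ∘ P?) l ∈ shuffles a b) (#trues-map l) (#falses-map l Q≡¬P) (∈-shuffles⁺ _)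

-- Linear orders respecting an orientation

T-not⁻ : ∀ {b} → T (not b) → ¬ T b
T-not⁻ {false} _ ()

T-not⁺ : ∀ {b} → ¬ T b → T (not b)
T-not⁺ {false} _   = _
T-not⁺ {true}  ¬tt = ¬tt _

data Precedes (x y : X) : List X → Set where
  here  : ∀ {zs} → y ∈ zs → Precedes x y (x ∷ zs)
  there : ∀ {z zs} → Precedes x y zs → Precedes x y (z ∷ zs)

Precedes-∈ˡ : ∀ {x y : X} {c} → Precedes x y c → x ∈ c
Precedes-∈ˡ (here _)  = here refl
Precedes-∈ˡ (there p) = there (Precedes-∈ˡ p)

Precedes-∈ʳ : ∀ {x y : X} {c} → Precedes x y c → y ∈ c
Precedes-∈ʳ (here y∈) = there y∈
Precedes-∈ʳ (there p) = there (Precedes-∈ʳ p)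

module _ (o : X → X → Bool) where

  respects⇒ : ∀ c → T (respects o c) → ∀ {x y} → Precedes x y c → ¬ T (o y x)
  respects⇒ (z ∷ zs) resp (here y∈)  = T-not⁻ (All.lookup (all⁺ _ zs (proj₁ (Equivalence.to T-∧ resp))) y∈)
  respects⇒ (z ∷ zs) resp (there p) = respects⇒ zs (proj₂ (Equivalence.to (T-∧ {all _ zs}) resp)) p

  respects⇐ : ∀ c → (∀ {x y} → Precedes x y c → ¬ T (o y x)) → T (respects o c)
  respects⇐ []       _   = _
  respects⇐ (z ∷ zs) ok = Equivalence.from T-∧
    (all⁻ _ (All.tabulate (λ y∈ → T-not⁺ (ok (here y∈)))) , respects⇐ zs (ok ∘ there))

  respects-cong : ∀ (o′ : X → X → Bool) c → (∀ {a b} → a ∈ c → b ∈ c → o a b ≡ o′ a b) → respects o c ≡ respects o′ c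
  respects-cong o′ []       _    = refl
  respects-cong o′ (z ∷ zs) o≡o′ =
    cong₂ _∧_ (cong and (map-cong-local (All.tabulate (λ y∈ → cong not (o≡o′ (there y∈) (here refl))))))
              (respects-cong o′ zs (λ a∈ b∈ → o≡o′ (there a∈) (there b∈)))

  module _ {P : X → Set} (P? : Decidable P) where

    Precedes-filter⁻ : ∀ c {x y} → Precedes x y (filter P? c) → Precedes x y c
    Precedes-filter⁻ (z ∷ zs) p with does (P? z) | p
    ... | false | p′         = there (Precedes-filter⁻ zs p′)
    ... | true  | here y∈    = here (proj₁ (∈-filter⁻ P? y∈))
    ... | true  | there p′   = there (Precedes-filter⁻ zs p′)

    Precedes-filter⁺ : ∀ c {x y} → Precedes x y c → P x → P y → Precedes x y (filter P? c)
    Precedes-filter⁺ (z ∷ zs) (here y∈) pz py rewrite filter-accept P? {xs = zs} pz = here (∈-filter⁺ P? y∈ py)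
    Precedes-filter⁺ (z ∷ zs) (there p) px py with does (P? z)
    ... | false = Precedes-filter⁺ zs p px py
    ... | true  = there (Precedes-filter⁺ zs p px py)

    respects-filter : ∀ c → T (respects o c) → T (respects o (filter P? c))
    respects-filter c resp = respects⇐ _ (respects⇒ c resp ∘ Precedes-filter⁻ c)

  respects-glue : ∀ {P Q : X → Set} (P? : Decidable P) (Q? : Decidable Q) c →
    (∀ {a b} → a ∈ c → b ∈ c → T (o a b) → (P a × P b) ⊎ (Q a × Q b)) →
    T (respects o (filter P? c)) → T (respects o (filter Q? c)) → T (respects o c)
  respects-glue P? Q? c local respP respQ = respects⇐ c ok
    where
      ok : ∀ {x y} → Precedes x y c → ¬ T (o y x)
      ok p oyx with local (Precedes-∈ʳ p) (Precedes-∈ˡ p) oyx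
      ... | inj₁ (py , px) = respects⇒ (filter P? c) respP (Precedes-filter⁺ P? c p px py) oyx
      ... | inj₂ (qy , qx) = respects⇒ (filter Q? c) respQ (Precedes-filter⁺ Q? c p qx qy) oyx

filter-middle : ∀ {P : X → Set} (P? : Decidable P) l {x} h → P x → filter P? (l ++ x ∷ h) ≡ filter P? l ++ x ∷ filter P? h
filter-middle P? l h px = ≡-trans (filter-++ P? l (_ ∷ h)) (cong (filter P? l ++_) (filter-accept P? px))

m+[1+n]∸1∸n≡m : ∀ m n → m + suc n ∸ 1 ∸ n ≡ m
m+[1+n]∸1∸n≡m m n = ≡-trans (cong (λ t → t ∸ 1 ∸ n) (+-suc m n)) (m+n∸n≡m m n)

length-prefix : ∀ (l : List X) x h → length l ≡ length (l ++ x ∷ h) ∸ 1 ∸ length h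
length-prefix l x h =
  sym (≡-trans (cong (λ n → n ∸ 1 ∸ length h) (length-++ l)) (m+[1+n]∸1∸n≡m (length l) (length h)))

gaps : ∀ {k} → Vec ℕ k → Vec ℕ k → Vec ℕ k
gaps ls rs = zipWith (λ li ri → li ∸ ri ∸ 1) ls rs

vsum-gaps : ∀ {k} {rs ls : Vec ℕ k} → Pointwise _<_ rs ls → vsum (gaps ls rs) + vsum rs + k ≡ vsum ls
vsum-gaps []                                      = refl
vsum-gaps {suc k} {r ∷ rs} {l ∷ ls} (r<l ∷ rs<ls) = begin
    (l ∸ r ∸ 1 + vsum (gaps ls rs)) + (r + vsum rs) + suc k
  ≡⟨ regroup (l ∸ r ∸ 1) r (vsum (gaps ls rs)) (vsum rs) k ⟩
    (l ∸ r ∸ 1 + suc r) + (vsum (gaps ls rs) + vsum rs + k)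
  ≡⟨ cong₂ _+_ gap+1+r≡l (vsum-gaps rs<ls) ⟩
    l + vsum ls ∎
  where
    open ≡-Reasoning
    regroup : ∀ d r G R k → (d + G) + (r + R) + suc k ≡ (d + suc r) + (G + R + k)
    regroup = solve-∀
    gap+1+r≡l : l ∸ r ∸ 1 + suc r ≡ l
    gap+1+r≡l = ≡-trans (cong (_+ suc r) (≡-trans (∸-+-assoc l r 1) (cong (l ∸_) (+-comm r 1)))) (m∸n+n≡m r<l)

-- Chambers

module Chambers {A : Set} (_≟_ : DecidableEquality A) (o : A → A → Bool) (α : A) where

  open Arrangements _≟_
  open import Data.List.Membership.DecPropositional _≟_ using (_∈?_)

  chambers : List A → ℕ → List (List A)
  chambers V r = filterᵇ (λ c → respects o c ∧ (after _≟_ α c ≡ᵇ r)) (perms V)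

  #chambers : List A → ℕ → ℕ
  #chambers V r = length (chambers V r)

  ∈-chambers⁻ : ∀ {V r c} → c ∈ chambers V r → c ↭ V × T (respects o c) × after _≟_ α c ≡ r
  ∈-chambers⁻ {V} {r} c∈ with ∈-filter⁻ (T? ∘ _) {xs = perms V} c∈
  ... | c∈perms , ok with Equivalence.to T-∧ ok
  ...   | resp , aft = ∈-perms⁻ V c∈perms , resp , ≡ᵇ⇒≡ _ r aft

  ∈-chambers⁺ : ∀ {V r c} → c ↭ V → T (respects o c) → after _≟_ α c ≡ r → c ∈ chambers V r
  ∈-chambers⁺ {V} {r} c↭V resp aft =
    ∈-filter⁺ (T? ∘ _) (∈-perms⁺ V c↭V) (Equivalence.from T-∧ (resp , ≡⇒≡ᵇ _ r aft))

  chambers-unique : ∀ V r → Unique V → Unique (chambers V r)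
  chambers-unique V r uV = Unique.filter⁺ _ (perms-unique V uV)

  record SplitChamber (V : List A) (r : ℕ) (l h : List A) : Set where
    field
      arranges   : l ++ α ∷ h ↭ V
      respectful : T (respects o (l ++ α ∷ h))
      α∉         : α ∉ l ++ h
      unique     : Unique (l ++ h)
      #above     : length h ≡ r
      #below     : length l ≡ length V ∸ 1 ∸ r

    α∉below : α ∉ l
    α∉below = α∉ ∘ ∈-++⁺ˡ

  split-chamber : ∀ {V r c} → Unique V → α ∈ V → c ∈ chambers V r →
    ∃₂ λ l h → c ≡ l ++ α ∷ h × SplitChamber V r l h
  split-chamber {V} {r} {c} uV α∈V c∈ with ∈-chambers⁻ c∈
  ... | c↭V , resp , aft with ∈-∃++ (∈-resp-↭ (↭-sym c↭V) α∈V)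
  ...   | l , h , refl with Unique-middle⁻ l h (Unique-resp-↭ (↭-sym c↭V) uV)
  ...     | α∉ , u = l , h , refl , record
    { arranges = c↭V ; respectful = resp ; α∉ = α∉ ; unique = u
    ; #above = #h≡r
    ; #below = ≡-trans (length-prefix l α h) (cong₂ (λ n m → n ∸ 1 ∸ m) (↭-length c↭V) #h≡r) }
    where
      #h≡r : length h ≡ r
      #h≡r = ≡-trans (sym (after-middle l h (α∉ ∘ ∈-++⁺ˡ))) aft

  after<length : ∀ c → α ∈ c → after _≟_ α c < length c
  after<length (x ∷ c) (here refl) rewrite dec-true (α ≟ α) refl = ≤-refl
  after<length (x ∷ c) (there α∈c) with does (x ≟ α)
  ... | true  = ≤-refl
  ... | false = m≤n⇒m≤1+n (after<length c α∈c)

  #chambers≢0⇒< : ∀ V r → α ∈ V → #chambers V r ≢ 0 → r < length V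
  #chambers≢0⇒< V r α∈V #≢0 with chambers V r in eq
  ... | []     = ⊥-elim (#≢0 refl)
  ... | c ∷ cs with ∈-chambers⁻ (subst (c ∈_) (sym eq) (here refl))
  ...   | c↭V , _ , aft = subst₂ _<_ aft (↭-length c↭V) (after<length c (∈-resp-↭ (↭-sym c↭V) α∈V))

  SplitChamber⇒∈ : ∀ {V r l h} → SplitChamber V r l h → l ++ α ∷ h ∈ chambers V r
  SplitChamber⇒∈ {l = l} {h} S = ∈-chambers⁺ arranges respectful (≡-trans (after-middle l h α∉below) #above)
    where open SplitChamber S

  restrict-↭ : ∀ {Π V c} → Unique Π → Unique V → (∀ {v} → v ∈ V → v ∈ Π) → c ↭ Π → filter (_∈? V) c ↭ V
  restrict-↭ {V = V} {c} uΠ uV V⊆Π c↭Π = unique-set⇒↭ (Unique.filter⁺ (_∈? V) (Unique-resp-↭ (↭-sym c↭Π) uΠ)) uV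
    (λ v∈ → proj₂ (∈-filter⁻ (_∈? V) {xs = c} v∈)) (λ v∈V → ∈-filter⁺ (_∈? V) (∈-resp-↭ (↭-sym c↭Π) (V⊆Π v∈V)) v∈V)

  restrict-split : ∀ {Π V r l h} → Unique Π → Unique V → (∀ {v} → v ∈ V → v ∈ Π) → α ∈ V →
    SplitChamber Π r l h →
    SplitChamber V (length (filter (_∈? V) h)) (filter (_∈? V) l) (filter (_∈? V) h)
  restrict-split {V = V} {l = l} {h} uΠ uV V⊆Π α∈V S = record
    { arranges   = arrangesV
    ; respectful = subst (T ∘ respects o) c∣V≡ (respects-filter o (_∈? V) (l ++ α ∷ h) respectful)
    ; α∉         = α∉ ∘ ∈-filter-++
    ; unique     = subst Unique (filter-++ (_∈? V) l h) (Unique.filter⁺ (_∈? V) unique)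
    ; #above     = refl
    ; #below     = ≡-trans (length-prefix (filter (_∈? V) l) α (filter (_∈? V) h))
                     (cong (λ n → n ∸ 1 ∸ length (filter (_∈? V) h)) (↭-length arrangesV))
    }
    where
      open SplitChamber S
      c∣V≡ : filter (_∈? V) (l ++ α ∷ h) ≡ filter (_∈? V) l ++ α ∷ filter (_∈? V) h
      c∣V≡ = filter-middle (_∈? V) l h α∈V
      arrangesV : filter (_∈? V) l ++ α ∷ filter (_∈? V) h ↭ V
      arrangesV = subst (_↭ V) c∣V≡ (restrict-↭ uΠ uV V⊆Π arranges)
      ∈-filter-++ : ∀ {x} → x ∈ filter (_∈? V) l ++ filter (_∈? V) h → x ∈ l ++ h
      ∈-filter-++ x∈ = proj₁ (∈-filter⁻ (_∈? V) (subst (_ ∈_) (sym (filter-++ (_∈? V) l h)) x∈))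

  module Gluing
    (U W Π : List A) (U-unique : Unique U) (W-unique : Unique W) (Π-unique : Unique Π)
    (α∈U : α ∈ U) (α∈W : α ∈ W) (U∩W⊆α : ∀ {v} → v ∈ U → v ∈ W → v ≡ α)
    (Π⊆U∪W : ∀ {v} → v ∈ Π → v ∈ U ⊎ v ∈ W) (U∪W⊆Π : ∀ {v} → v ∈ U ⊎ v ∈ W → v ∈ Π)
    (o-local : ∀ {a b} → a ∈ Π → b ∈ Π → T (o a b) → (a ∈ U × b ∈ U) ⊎ (a ∈ W × b ∈ W))
    where

    _∣U _∣W : List A → List A
    c ∣U = filter (_∈? U) c
    c ∣W = filter (_∈? W) c

    inU : A → Bool
    inU v = does (v ∈? U)

    inW≡not-inU : ∀ {v} → v ∈ Π → v ≢ α → does (v ∈? W) ≡ not (inU v)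
    inW≡not-inU {v} v∈Π v≢α with Π⊆U∪W v∈Π
    ... | inj₁ v∈U rewrite dec-true (v ∈? U) v∈U | dec-false (v ∈? W) (v≢α ∘ U∩W⊆α v∈U) = refl
    ... | inj₂ v∈W rewrite dec-true (v ∈? W) v∈W | dec-false (v ∈? U) (v≢α ∘ λ v∈U → U∩W⊆α v∈U v∈W) = refl

    chambers-by-U : ℕ → ℕ → List (List A)
    chambers-by-U r j = filterᵇ (λ c → (respects o c ∧ (after _≟_ α c ≡ᵇ r)) ∧ (after _≟_ α (c ∣U) ≡ᵇ j)) (perms Π)

    ∈-chambers-by-U⁻ : ∀ {r j c} → c ∈ chambers-by-U r j → c ∈ chambers Π r × after _≟_ α (c ∣U) ≡ j
    ∈-chambers-by-U⁻ {r} {j} c∈ with ∈-filter⁻ (T? ∘ _) {xs = perms Π} c∈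
    ... | c∈perms , ok with Equivalence.to T-∧ ok
    ...   | ch , aftU = ∈-filter⁺ (T? ∘ _) c∈perms ch , ≡ᵇ⇒≡ _ j aftU

    ∈-chambers-by-U⁺ : ∀ {r j c} → c ∈ chambers Π r → after _≟_ α (c ∣U) ≡ j → c ∈ chambers-by-U r j
    ∈-chambers-by-U⁺ {r} {j} c∈ aftU with ∈-filter⁻ (T? ∘ _) {xs = perms Π} c∈
    ... | c∈perms , ch = ∈-filter⁺ (T? ∘ _) c∈perms (Equivalence.from T-∧ (ch , ≡⇒≡ᵇ _ j aftU))

    Quadruple : Set
    Quadruple = List A × List A × List Bool × List Bool

    quadruples : ℕ → ℕ → List Quadruple
    quadruples r j = cartesianProduct (chambers U j) (cartesianProduct (chambers W (r ∸ j))
      (cartesianProduct (shuffles (length U ∸ 1 ∸ j) (length W ∸ 1 ∸ (r ∸ j))) (shuffles j (r ∸ j))))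

    -- The words record which positions below and above α hold vertices of U.
    split : List A → Quadruple
    split c = c ∣U , c ∣W , map inU (below α c) , map inU (above α c)

    glue : Quadruple → List A
    glue (c₁ , c₂ , w , w′) = interleave w (below α c₁) (below α c₂) ++ α ∷ interleave w′ (above α c₁) (above α c₂)

    α∈Π : α ∈ Π
    α∈Π = U∪W⊆Π (inj₁ α∈U)

    restrictU : ∀ {r l h} → SplitChamber Π r l h → SplitChamber U (length (h ∣U)) (l ∣U) (h ∣U)
    restrictU = restrict-split Π-unique U-unique (U∪W⊆Π ∘ inj₁) α∈U

    restrictW : ∀ {r l h} → SplitChamber Π r l h → SplitChamber W (length (h ∣W)) (l ∣W) (h ∣W)
    restrictW = restrict-split Π-unique W-unique (U∪W⊆Π ∘ inj₂) α∈W

    complementary : ∀ {r l h} → SplitChamber Π r l h → ∀ {x} → x ∈ l ++ h → does (x ∈? W) ≡ not (inU x)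
    complementary {l = l} {h} S x∈ =
      inW≡not-inU (∈-resp-↭ (SplitChamber.arranges S) (∈-middle⁺ l h (inj₂ x∈))) (λ { refl → SplitChamber.α∉ S x∈ })

    glue∘split : ∀ {r l h} → SplitChamber Π r l h → glue (split (l ++ α ∷ h)) ≡ l ++ α ∷ h
    glue∘split {l = l} {h} S
      rewrite below-middle l h (SplitChamber.α∉below S) | above-middle l h (SplitChamber.α∉below S)
            | filter-middle (_∈? U) l h α∈U | filter-middle (_∈? W) l h α∈W
            | below-middle (l ∣U) (h ∣U) (SplitChamber.α∉below (restrictU S))
            | above-middle (l ∣U) (h ∣U) (SplitChamber.α∉below (restrictU S))
            | below-middle (l ∣W) (h ∣W) (SplitChamber.α∉below (restrictW S))
            | above-middle (l ∣W) (h ∣W) (SplitChamber.α∉below (restrictW S))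
            | interleave-split (_∈? U) (_∈? W) l (complementary S ∘ ∈-++⁺ˡ)
            | interleave-split (_∈? U) (_∈? W) h (complementary S ∘ ∈-++⁺ʳ l) = refl

    split-∈ : ∀ {r j c} → c ∈ chambers-by-U r j → split c ∈ quadruples r j × glue (split c) ≡ c
    split-∈ {r} {j} c∈ with ∈-chambers-by-U⁻ c∈
    ... | c∈ch , aftU with split-chamber Π-unique α∈Π c∈ch
    ...   | l , h , refl , S =
      ∈-cartesianProduct⁺ c∣U∈ (∈-cartesianProduct⁺ c∣W∈ (∈-cartesianProduct⁺ w∈ w′∈)) , glue∘split S
      where
        open SplitChamber S
        SU : SplitChamber U (length (h ∣U)) (l ∣U) (h ∣U)
        SU = restrictU S
        SW : SplitChamber W (length (h ∣W)) (l ∣W) (h ∣W)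
        SW = restrictW S
        #h∣U≡j : length (h ∣U) ≡ j
        #h∣U≡j = begin
          length (h ∣U)                      ≡⟨ after-middle (l ∣U) (h ∣U) (SplitChamber.α∉below SU) ⟨
          after _≟_ α (l ∣U ++ α ∷ h ∣U)     ≡⟨ cong (after _≟_ α) (filter-middle (_∈? U) l h α∈U) ⟨
          after _≟_ α ((l ++ α ∷ h) ∣U)      ≡⟨ aftU ⟩
          j                                  ∎
          where open ≡-Reasoning
        #h∣W≡r∸j : length (h ∣W) ≡ r ∸ j
        #h∣W≡r∸j = begin
          length (h ∣W)                                  ≡⟨ m+n∸m≡n (length (h ∣U)) _ ⟨
          length (h ∣U) + length (h ∣W) ∸ length (h ∣U)  ≡⟨ cong₂ _∸_ (sym (length-filter-split (_∈? U) (_∈? W) h (complementary S ∘ ∈-++⁺ʳ l))) #h∣U≡j ⟩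
          length h ∸ j                                   ≡⟨ cong (_∸ j) #above ⟩
          r ∸ j                                          ∎
          where open ≡-Reasoning
        c∣U∈ : (l ++ α ∷ h) ∣U ∈ chambers U j
        c∣U∈ = subst₂ (λ c n → c ∈ chambers U n) (sym (filter-middle (_∈? U) l h α∈U)) #h∣U≡j (SplitChamber⇒∈ SU)
        c∣W∈ : (l ++ α ∷ h) ∣W ∈ chambers W (r ∸ j)
        c∣W∈ = subst₂ (λ c n → c ∈ chambers W n) (sym (filter-middle (_∈? W) l h α∈W)) #h∣W≡r∸j (SplitChamber⇒∈ SW)
        w∈ : map inU (below α (l ++ α ∷ h)) ∈ shuffles (length U ∸ 1 ∸ j) (length W ∸ 1 ∸ (r ∸ j))
        w∈ rewrite below-middle l h α∉below = subst₂ (λ a b → map inU l ∈ shuffles a b)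
          (≡-trans (SplitChamber.#below SU) (cong (λ n → length U ∸ 1 ∸ n) #h∣U≡j))
          (≡-trans (SplitChamber.#below SW) (cong (λ n → length W ∸ 1 ∸ n) #h∣W≡r∸j))
          (map-does-∈-shuffles (_∈? U) (_∈? W) l (complementary S ∘ ∈-++⁺ˡ))
        w′∈ : map inU (above α (l ++ α ∷ h)) ∈ shuffles j (r ∸ j)
        w′∈ rewrite above-middle l h α∉below = subst₂ (λ a b → map inU h ∈ shuffles a b) #h∣U≡j #h∣W≡r∸j
          (map-does-∈-shuffles (_∈? U) (_∈? W) h (complementary S ∘ ∈-++⁺ʳ l))

    module Glued {j s l₁ h₁ l₂ h₂} (S₁ : SplitChamber U j l₁ h₁) (S₂ : SplitChamber W s l₂ h₂)
                 {w w′ : List Bool} (#tw : #trues w ≡ length l₁) (#fw : #falses w ≡ length l₂)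
                 (#tw′ : #trues w′ ≡ length h₁) (#fw′ : #falses w′ ≡ length h₂) where

      private
        module S₁ = SplitChamber S₁
        module S₂ = SplitChamber S₂

      I₁ I₂ M : List A
      I₁ = interleave w l₁ l₂
      I₂ = interleave w′ h₁ h₂
      M  = I₁ ++ α ∷ I₂

      ∈U : ∀ {x} → x ∈ l₁ ++ h₁ → x ∈ U
      ∈U x∈ = ∈-resp-↭ S₁.arranges (∈-middle⁺ l₁ h₁ (inj₂ x∈))

      ∈W : ∀ {x} → x ∈ l₂ ++ h₂ → x ∈ W
      ∈W x∈ = ∈-resp-↭ S₂.arranges (∈-middle⁺ l₂ h₂ (inj₂ x∈))

      ∉W : ∀ {x} → x ∈ l₁ ++ h₁ → x ∉ W
      ∉W x∈ x∈W = S₁.α∉ (subst (_∈ l₁ ++ h₁) (U∩W⊆α (∈U x∈) x∈W) x∈)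

      ∉U : ∀ {x} → x ∈ l₂ ++ h₂ → x ∉ U
      ∉U x∈ x∈U = S₂.α∉ (subst (_∈ l₂ ++ h₂) (U∩W⊆α x∈U (∈W x∈)) x∈)

      I₁++I₂↭ : I₁ ++ I₂ ↭ (l₁ ++ h₁) ++ (l₂ ++ h₂)
      I₁++I₂↭ = trans (++⁺ (interleave-↭ w l₁ l₂ #tw #fw) (interleave-↭ w′ h₁ h₂ #tw′ #fw′)) (++-interchange-↭ l₁ l₂ h₁ h₂)

      α∉I₁++I₂ : α ∉ I₁ ++ I₂
      α∉I₁++I₂ α∈ with ∈-++⁻ (l₁ ++ h₁) (∈-resp-↭ I₁++I₂↭ α∈)
      ... | inj₁ α∈₁ = S₁.α∉ α∈₁
      ... | inj₂ α∈₂ = S₂.α∉ α∈₂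

      M-unique : Unique M
      M-unique = Unique-middle⁺ I₁ I₂ α∉I₁++I₂
        (Unique-resp-↭ (↭-sym I₁++I₂↭) (Unique.++⁺ S₁.unique S₂.unique (λ (x∈₁ , x∈₂) → ∉W x∈₁ (∈W x∈₂))))

      M∣U≡ : M ∣U ≡ l₁ ++ α ∷ h₁
      M∣U≡ = ≡-trans (filter-middle (_∈? U) I₁ I₂ α∈U) (cong₂ (λ a b → a ++ α ∷ b)
        (filter-interleaveˡ (_∈? U) w l₁ l₂ #tw #fw (All.tabulate (∈U ∘ ∈-++⁺ˡ)) (All.tabulate (∉U ∘ ∈-++⁺ˡ)))
        (filter-interleaveˡ (_∈? U) w′ h₁ h₂ #tw′ #fw′ (All.tabulate (∈U ∘ ∈-++⁺ʳ l₁)) (All.tabulate (∉U ∘ ∈-++⁺ʳ l₂))))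

      M∣W≡ : M ∣W ≡ l₂ ++ α ∷ h₂
      M∣W≡ = ≡-trans (filter-middle (_∈? W) I₁ I₂ α∈W) (cong₂ (λ a b → a ++ α ∷ b)
        (filter-interleaveʳ (_∈? W) w l₁ l₂ #tw #fw (All.tabulate (∉W ∘ ∈-++⁺ˡ)) (All.tabulate (∈W ∘ ∈-++⁺ˡ)))
        (filter-interleaveʳ (_∈? W) w′ h₁ h₂ #tw′ #fw′ (All.tabulate (∉W ∘ ∈-++⁺ʳ l₁)) (All.tabulate (∈W ∘ ∈-++⁺ʳ l₂))))

      M⊆Π : ∀ {x} → x ∈ M → x ∈ Π
      M⊆Π x∈ with ∈-middle⁻ I₁ I₂ x∈
      ... | inj₁ refl = α∈Π
      ... | inj₂ x∈I with ∈-++⁻ (l₁ ++ h₁) (∈-resp-↭ I₁++I₂↭ x∈I)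
      ...   | inj₁ x∈₁ = U∪W⊆Π (inj₁ (∈U x∈₁))
      ...   | inj₂ x∈₂ = U∪W⊆Π (inj₂ (∈W x∈₂))

      Π⊆M : ∀ {x} → x ∈ Π → x ∈ M
      Π⊆M x∈ with Π⊆U∪W x∈
      ... | inj₁ x∈U = proj₁ (∈-filter⁻ (_∈? U) {xs = M} (subst (_ ∈_) (sym M∣U≡) (∈-resp-↭ (↭-sym S₁.arranges) x∈U)))
      ... | inj₂ x∈W = proj₁ (∈-filter⁻ (_∈? W) {xs = M} (subst (_ ∈_) (sym M∣W≡) (∈-resp-↭ (↭-sym S₂.arranges) x∈W)))

      M↭Π : M ↭ Π
      M↭Π = unique-set⇒↭ M-unique Π-unique M⊆Π Π⊆M

      M-respects : T (respects o M)
      M-respects = respects-glue o (_∈? U) (_∈? W) M (λ a∈ b∈ → o-local (M⊆Π a∈) (M⊆Π b∈))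
        (subst (T ∘ respects o) (sym M∣U≡) S₁.respectful) (subst (T ∘ respects o) (sym M∣W≡) S₂.respectful)

      α∉I₁ : α ∉ I₁
      α∉I₁ = α∉I₁++I₂ ∘ ∈-++⁺ˡ

      after-M : after _≟_ α M ≡ j + s
      after-M = begin
        after _≟_ α M         ≡⟨ after-middle I₁ I₂ α∉I₁ ⟩
        length I₂             ≡⟨ ↭-length (interleave-↭ w′ h₁ h₂ #tw′ #fw′) ⟩
        length (h₁ ++ h₂)     ≡⟨ length-++ h₁ ⟩
        length h₁ + length h₂ ≡⟨ cong₂ _+_ S₁.#above S₂.#above ⟩
        j + s                 ∎
        where open ≡-Reasoning

      after-M∣U : after _≟_ α (M ∣U) ≡ j
      after-M∣U = ≡-trans (cong (after _≟_ α) M∣U≡) (≡-trans (after-middle l₁ h₁ S₁.α∉below) S₁.#above)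

      split-M : split M ≡ (l₁ ++ α ∷ h₁ , l₂ ++ α ∷ h₂ , w , w′)
      split-M = cong₂ _,_ M∣U≡ (cong₂ _,_ M∣W≡ (cong₂ _,_
        (≡-trans (cong (map inU) (below-middle I₁ I₂ α∉I₁))
                 (map-interleave (_∈? U) w l₁ l₂ #tw #fw (All.tabulate (∈U ∘ ∈-++⁺ˡ)) (All.tabulate (∉U ∘ ∈-++⁺ˡ))))
        (≡-trans (cong (map inU) (above-middle I₁ I₂ α∉I₁))
                 (map-interleave (_∈? U) w′ h₁ h₂ #tw′ #fw′ (All.tabulate (∈U ∘ ∈-++⁺ʳ l₁)) (All.tabulate (∉U ∘ ∈-++⁺ʳ l₂))))))

    glue-∈ : ∀ {r j t} → j ≤ r → t ∈ quadruples r j → glue t ∈ chambers-by-U r j × split (glue t) ≡ t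
    glue-∈ {r} {j} {c₁ , c₂ , w , w′} j≤r t∈
      with ∈-cartesianProduct⁻ (chambers U j) _ t∈
    ... | c₁∈ , t∈′ with ∈-cartesianProduct⁻ (chambers W (r ∸ j)) _ t∈′
    ... | c₂∈ , t∈″ with ∈-cartesianProduct⁻ (shuffles (length U ∸ 1 ∸ j) (length W ∸ 1 ∸ (r ∸ j))) _ t∈″
    ... | w∈ , w′∈ with split-chamber U-unique α∈U c₁∈ | split-chamber W-unique α∈W c₂∈
    ... | l₁ , h₁ , refl , S₁ | l₂ , h₂ , refl , S₂ =
      subst (_∈ chambers-by-U r j) (sym glue≡M) M∈ , ≡-trans (cong split glue≡M) split-M
      where
        #w : #trues w ≡ length U ∸ 1 ∸ j × #falses w ≡ length W ∸ 1 ∸ (r ∸ j)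
        #w = ∈-shuffles⁻ _ _ w∈
        #w′ : #trues w′ ≡ j × #falses w′ ≡ r ∸ j
        #w′ = ∈-shuffles⁻ _ _ w′∈
        open Glued S₁ S₂ {w} {w′} (≡-trans (proj₁ #w) (sym (SplitChamber.#below S₁))) (≡-trans (proj₂ #w) (sym (SplitChamber.#below S₂)))
                         (≡-trans (proj₁ #w′) (sym (SplitChamber.#above S₁))) (≡-trans (proj₂ #w′) (sym (SplitChamber.#above S₂)))
        glue≡M : glue (l₁ ++ α ∷ h₁ , l₂ ++ α ∷ h₂ , w , w′) ≡ M
        glue≡M rewrite below-middle l₁ h₁ (SplitChamber.α∉below S₁) | above-middle l₁ h₁ (SplitChamber.α∉below S₁)
                     | below-middle l₂ h₂ (SplitChamber.α∉below S₂) | above-middle l₂ h₂ (SplitChamber.α∉below S₂) = refl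
        M∈ : M ∈ chambers-by-U r j
        M∈ = ∈-chambers-by-U⁺ (∈-chambers⁺ M↭Π M-respects (≡-trans after-M (m+[n∸m]≡n j≤r))) after-M∣U

    #chambers-by-U : ∀ r j → j ≤ r → length (chambers-by-U r j) ≡
      #chambers U j * (#chambers W (r ∸ j) * (#shuffles (length U ∸ 1 ∸ j) (length W ∸ 1 ∸ (r ∸ j)) * #shuffles j (r ∸ j)))
    #chambers-by-U r j j≤r = ≡-trans
      (length-≡-by-inverses split glue chambers-by-U-unique quadruples-unique
        (proj₁ ∘ split-∈) (proj₂ ∘ split-∈) (proj₁ ∘ glue-∈ j≤r) (proj₂ ∘ glue-∈ j≤r))
      (≡-trans (length-cartesianProduct (chambers U j) _) (cong (#chambers U j *_)
        (≡-trans (length-cartesianProduct (chambers W (r ∸ j)) _) (cong (#chambers W (r ∸ j) *_)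
          (length-cartesianProduct (shuffles (length U ∸ 1 ∸ j) (length W ∸ 1 ∸ (r ∸ j))) _)))))
      where
        chambers-by-U-unique : Unique (chambers-by-U r j)
        chambers-by-U-unique = Unique.filter⁺ _ (perms-unique Π Π-unique)
        quadruples-unique : Unique (quadruples r j)
        quadruples-unique = Unique.cartesianProduct⁺ (chambers-unique U j U-unique)
          (Unique.cartesianProduct⁺ (chambers-unique W (r ∸ j) W-unique)
            (Unique.cartesianProduct⁺ (shuffles-unique (length U ∸ 1 ∸ j) (length W ∸ 1 ∸ (r ∸ j))) (shuffles-unique j (r ∸ j))))

    #chambers-glued : ∀ r → #chambers Π r ≡ sumUpTo r (λ j →
      #chambers U j * (#chambers W (r ∸ j) * (#shuffles (length U ∸ 1 ∸ j) (length W ∸ 1 ∸ (r ∸ j)) * #shuffles j (r ∸ j))))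
    #chambers-glued r = ≡-trans
      (length-filterᵇ-by-value (λ c → respects o c ∧ (after _≟_ α c ≡ᵇ r)) (λ c → after _≟_ α (c ∣U)) r (perms Π) after∣U≤r)
      (sumUpTo-cong r (λ j j≤r → #chambers-by-U r j j≤r))
      where
        after∣U≤r : ∀ {c} → c ∈ perms Π → T (respects o c ∧ (after _≟_ α c ≡ᵇ r)) → after _≟_ α (c ∣U) ≤ r
        after∣U≤r c∈ ok with split-chamber Π-unique α∈Π (∈-filter⁺ (T? ∘ _) c∈ ok)
        ... | l , h , refl , S = begin
          after _≟_ α ((l ++ α ∷ h) ∣U)  ≡⟨ cong (after _≟_ α) (filter-middle (_∈? U) l h α∈U) ⟩
          after _≟_ α (l ∣U ++ α ∷ h ∣U) ≡⟨ after-middle (l ∣U) (h ∣U) (SplitChamber.α∉below S ∘ proj₁ ∘ ∈-filter⁻ (_∈? U)) ⟩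
          length (h ∣U)                  ≤⟨ length-filter (_∈? U) h ⟩
          length h                       ≡⟨ SplitChamber.#above S ⟩
          r                              ∎
          where open ≤-Reasoning

    length-glued : length Π + 1 ≡ length U + length W
    length-glued with ∈-∃++ α∈W
    ... | lW , hW , refl with Unique-middle⁻ lW hW W-unique
    ...   | α∉W′ , W′-unique = begin
      length Π + 1                   ≡⟨ cong (_+ 1) (↭-length Π↭) ⟩
      length (U ++ W′) + 1           ≡⟨ cong (_+ 1) (length-++ U) ⟩
      length U + length W′ + 1       ≡⟨ +-assoc (length U) (length W′) 1 ⟩
      length U + (length W′ + 1)     ≡⟨ cong (length U +_) (+-comm (length W′) 1) ⟩
      length U + suc (length W′)     ≡⟨ cong (length U +_) (↭-length (shift α lW hW)) ⟨
      length U + length (lW ++ α ∷ hW) ∎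
      where
        open ≡-Reasoning
        W′ : List A
        W′ = lW ++ hW
        W′⊆W : ∀ {x} → x ∈ W′ → x ∈ lW ++ α ∷ hW
        W′⊆W = ∈-middle⁺ lW hW ∘ inj₂
        Π↭ : Π ↭ U ++ W′
        Π↭ = unique-set⇒↭ Π-unique
          (Unique.++⁺ U-unique W′-unique (λ (x∈U , x∈W′) → α∉W′ (subst (_∈ W′) (U∩W⊆α x∈U (W′⊆W x∈W′)) x∈W′)))
          (λ x∈ → [ ∈-++⁺ˡ , (λ x∈W → [ (λ { refl → ∈-++⁺ˡ α∈U }) , ∈-++⁺ʳ U ]′ (∈-middle⁻ lW hW x∈W)) ]′ (Π⊆U∪W x∈))
          (λ x∈ → U∪W⊆Π ([ inj₁ , inj₂ ∘ W′⊆W ]′ (∈-++⁻ U x∈)))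

  record Wedge {k} (Πs : Fin k → List A) (Π : List A) : Set where
    field
      blocks-unique : ∀ i → Unique (Πs i)
      α∈blocks      : ∀ i → α ∈ Πs i
      blocks-meet   : ∀ i j → i ≢ j → ∀ {v} → v ∈ Πs i → v ∈ Πs j → v ≡ α
      unique        : Unique Π
      covered       : ∀ {v} → v ∈ Π → ∃ λ i → v ∈ Πs i
      included      : ∀ i {v} → v ∈ Πs i → v ∈ Π
      o-local       : ∀ {a b} → a ∈ Π → b ∈ Π → T (o a b) → ∃ λ i → a ∈ Πs i × b ∈ Πs i

  tail-union : ∀ {k} → (Fin (suc k) → List A) → List A → List A
  tail-union Πs Π = filter (λ v → any? (λ i → v ∈? Πs (suc i))) Π

  module _ {k} {Πs : Fin (suc (suc k)) → List A} {Π} (wedge : Wedge Πs Π) where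

    open Wedge wedge

    private
      Π′ : List A
      Π′ = tail-union Πs Π

      ⊆Π : ∀ {v} → v ∈ Π′ → v ∈ Π
      ⊆Π = proj₁ ∘ ∈-filter⁻ _

      included′ : ∀ i {v} → v ∈ Πs (suc i) → v ∈ Π′
      included′ i v∈ = ∈-filter⁺ _ (included (suc i) v∈) (i , v∈)

      head∩tail⊆α : ∀ {v} → v ∈ Πs zero → v ∈ Π′ → v ≡ α
      head∩tail⊆α v∈₀ v∈′ with proj₂ (∈-filter⁻ _ {xs = Π} v∈′)
      ... | i , v∈ᵢ = blocks-meet zero (suc i) (λ ()) v∈₀ v∈ᵢ

    tail-wedge : Wedge (Πs ∘ suc) Π′
    tail-wedge = record
      { blocks-unique = blocks-unique ∘ suc
      ; α∈blocks      = α∈blocks ∘ suc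
      ; blocks-meet   = λ i j i≢j → blocks-meet (suc i) (suc j) (i≢j ∘ Fin.suc-injective)
      ; unique        = Unique.filter⁺ _ unique
      ; covered       = λ v∈ → proj₂ (∈-filter⁻ _ {xs = Π} v∈)
      ; included      = included′
      ; o-local       = o-local′
      }
      where
        o-local′ : ∀ {a b} → a ∈ Π′ → b ∈ Π′ → T (o a b) → ∃ λ i → a ∈ Πs (suc i) × b ∈ Πs (suc i)
        o-local′ a∈ b∈ oab with o-local (⊆Π a∈) (⊆Π b∈) oab
        ... | suc i , a∈ᵢ , b∈ᵢ = i , a∈ᵢ , b∈ᵢ
        ... | zero  , a∈₀ , b∈₀ rewrite head∩tail⊆α a∈₀ a∈ | head∩tail⊆α b∈₀ b∈ =
          zero , α∈blocks (suc zero) , α∈blocks (suc zero)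

    private
      in-head-or-tail : ∀ {v} → ∃ (λ i → v ∈ Πs i) → v ∈ Πs zero ⊎ v ∈ Π′
      in-head-or-tail (zero  , v∈) = inj₁ v∈
      in-head-or-tail (suc i , v∈) = inj₂ (included′ i v∈)

      o-local-glued : ∀ {a b} → a ∈ Π → b ∈ Π → T (o a b) → (a ∈ Πs zero × b ∈ Πs zero) ⊎ (a ∈ Π′ × b ∈ Π′)
      o-local-glued a∈ b∈ oab with o-local a∈ b∈ oab
      ... | zero  , a∈₀ , b∈₀ = inj₁ (a∈₀ , b∈₀)
      ... | suc i , a∈ᵢ , b∈ᵢ = inj₂ (included′ i a∈ᵢ , included′ i b∈ᵢ)

    open Gluing (Πs zero) Π′ Π (blocks-unique zero) (Wedge.unique tail-wedge) unique
      (α∈blocks zero) (included′ zero (α∈blocks (suc zero))) head∩tail⊆α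
      (in-head-or-tail ∘ covered) [ included zero , ⊆Π ]′ o-local-glued
      public
      using (#chambers-glued; length-glued)

  #chambers-resp-↭ : ∀ {V V′} r → Unique V → Unique V′ → V ↭ V′ → #chambers V r ≡ #chambers V′ r
  #chambers-resp-↭ r uV uV′ V↭V′ = length-≡-by-inverses (λ c → c) (λ c → c)
    (chambers-unique _ r uV) (chambers-unique _ r uV′)
    (transport V↭V′) (λ _ → refl) (transport (↭-sym V↭V′)) (λ _ → refl)
    where
      transport : ∀ {V V′ c} → V ↭ V′ → c ∈ chambers V r → c ∈ chambers V′ r
      transport V↭V′ c∈ with ∈-chambers⁻ c∈
      ... | c↭V , resp , aft = ∈-chambers⁺ (trans c↭V V↭V′) resp aft

  #chambers-beyond : ∀ V r → α ∈ V → length V ≤ r → #chambers V r ≡ 0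
  #chambers-beyond V r α∈V |V|≤r with #chambers V r ≟ℕ 0
  ... | yes #≡0 = #≡0
  ... | no  #≢0 = ⊥-elim (<⇒≱ (#chambers≢0⇒< V r α∈V #≢0) |V|≤r)

  lengths : ∀ {k} → (Fin k → List A) → Vec ℕ k
  lengths Πs = tabulate (length ∘ Πs)

  prod#chambers : ∀ {k} → (Fin k → List A) → Vec ℕ k → ℕ
  prod#chambers Πs []       = 1
  prod#chambers Πs (r ∷ rs) = #chambers (Πs zero) r * prod#chambers (Πs ∘ suc) rs

  term : ∀ {k} → (Fin k → List A) → Vec ℕ k → ℕ
  term Πs rs = prod#chambers Πs rs * multinomial rs * multinomial (gaps (lengths Πs) rs)

  prod#chambers≢0⇒< : ∀ {k} (Πs : Fin k → List A) → (∀ i → α ∈ Πs i) → ∀ rs →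
    prod#chambers Πs rs ≢ 0 → Pointwise _<_ rs (lengths Πs)
  prod#chambers≢0⇒< Πs α∈ []       _   = []
  prod#chambers≢0⇒< Πs α∈ (r ∷ rs) ≢0 =
    #chambers≢0⇒< (Πs zero) r (α∈ zero) (λ #≡0 → ≢0 (cong (_* prod#chambers (Πs ∘ suc) rs) #≡0))
    ∷ prod#chambers≢0⇒< (Πs ∘ suc) (α∈ ∘ suc) rs
        (λ P≡0 → ≢0 (≡-trans (cong (#chambers (Πs zero) r *_) P≡0) (*-zeroʳ (#chambers (Πs zero) r))))

  term-outside-box : ∀ {k} (Πs : Fin k → List A) N → (∀ i → α ∈ Πs i) → (∀ i → length (Πs i) ≤ N) →
    ∀ rs → OutsideBox N rs → term Πs rs ≡ 0
  term-outside-box Πs N α∈ ≤N rs out = cong (λ P → P * multinomial rs * multinomial (gaps (lengths Πs) rs)) (prod≡0 Πs α∈ ≤N rs out)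
    where
      prod≡0 : ∀ {k} (Πs : Fin k → List A) → (∀ i → α ∈ Πs i) → (∀ i → length (Πs i) ≤ N) →
        ∀ rs → OutsideBox N rs → prod#chambers Πs rs ≡ 0
      prod≡0 Πs α∈ ≤N (r ∷ rs) (inj₁ N<r) =
        cong (_* prod#chambers (Πs ∘ suc) rs) (#chambers-beyond (Πs zero) r (α∈ zero) (≤-trans (≤N zero) (<⇒≤ N<r)))
      prod≡0 Πs α∈ ≤N (r ∷ rs) (inj₂ out) =
        ≡-trans (cong (#chambers (Πs zero) r *_) (prod≡0 (Πs ∘ suc) (α∈ ∘ suc) (≤N ∘ suc) rs out)) (*-zeroʳ (#chambers (Πs zero) r))

  -- The two shuffle counts of a gluing step are the factors by which both multinomials
  -- grow when a block is put in front.
  term-∷ : ∀ {k} (Πs : Fin (suc k) → List A) L′ j v →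
    (prod#chambers (Πs ∘ suc) v ≢ 0 → vsum (gaps (lengths (Πs ∘ suc)) v) ≡ L′ ∸ 1 ∸ vsum v) →
    #chambers (Πs zero) j * (#shuffles (length (Πs zero) ∸ 1 ∸ j) (L′ ∸ 1 ∸ vsum v) * #shuffles j (vsum v))
      * term (Πs ∘ suc) v
    ≡ term Πs (j ∷ v)
  term-∷ {k} Πs L′ j v gaps≡ with prod#chambers (Πs ∘ suc) v in P≡
  ... | zero  = ≡-trans (*-zeroʳ (C * (#shuffles (ℓ ∸ 1 ∸ j) (L′ ∸ 1 ∸ vsum v) * #shuffles j (vsum v))))
                        (cong (λ t → t * multinomial (j ∷ v) * multinomial (gaps (lengths Πs) (j ∷ v))) (sym (*-zeroʳ C)))
    where
      C ℓ : ℕ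
      C = #chambers (Πs zero) j
      ℓ = length (Πs zero)
  ... | suc P = begin
      C * (#shuffles (ℓ ∸ 1 ∸ j) (L′ ∸ 1 ∸ vsum v) * #shuffles j (vsum v)) * (suc P * multinomial v * multinomial G)
    ≡⟨ cong (λ t → C * (#shuffles (ℓ ∸ 1 ∸ j) t * #shuffles j (vsum v)) * (suc P * multinomial v * multinomial G))
            (sym (gaps≡ (λ ()))) ⟩
      C * (#shuffles (ℓ ∸ 1 ∸ j) (vsum G) * #shuffles j (vsum v)) * (suc P * multinomial v * multinomial G)
    ≡⟨ regroup C (#shuffles (ℓ ∸ 1 ∸ j) (vsum G)) (#shuffles j (vsum v)) (suc P) (multinomial v) (multinomial G) ⟩
      C * suc P * (#shuffles j (vsum v) * multinomial v) * (#shuffles (ℓ ∸ 1 ∸ j) (vsum G) * multinomial G)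
    ≡⟨ cong₂ (λ a b → C * suc P * a * b) (sym (multinomial-∷ j v))
         (≡-trans (cong (λ t → #shuffles t (vsum G) * multinomial G) ℓ∸1∸j≡ℓ∸j∸1) (sym (multinomial-∷ (ℓ ∸ j ∸ 1) G))) ⟩
      C * suc P * multinomial (j ∷ v) * multinomial ((ℓ ∸ j ∸ 1) ∷ G) ∎
    where
      open ≡-Reasoning
      C ℓ : ℕ
      C = #chambers (Πs zero) j
      ℓ = length (Πs zero)
      G : Vec ℕ k
      G = gaps (lengths (Πs ∘ suc)) v
      regroup : ∀ C B₁ B₂ P M Z → C * (B₁ * B₂) * (P * M * Z) ≡ C * P * (B₂ * M) * (B₁ * Z)
      regroup = solve-∀
      ℓ∸1∸j≡ℓ∸j∸1 : ℓ ∸ 1 ∸ j ≡ ℓ ∸ j ∸ 1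
      ℓ∸1∸j≡ℓ∸j∸1 = ≡-trans (∸-+-assoc ℓ 1 j) (≡-trans (cong (ℓ ∸_) (+-comm 1 j)) (sym (∸-+-assoc ℓ j 1)))

  WedgeCount : ∀ k → (Fin (suc k) → List A) → List A → Set
  WedgeCount k Πs Π = (∀ r → #chambers Π r ≡ sumComp (suc k) r (term Πs)) × (length Π + k ≡ vsum (lengths Πs))

  wedge-count-single : ∀ {Πs : Fin 1 → List A} {Π} → Wedge Πs Π → WedgeCount 0 Πs Π
  wedge-count-single {Πs} {Π} wedge =
    (λ r → ≡-trans (#chambers-resp-↭ r unique (blocks-unique zero) Π↭Π₀) (sym (≡-trans (sumComp-one r (term Πs)) (term-[ r ])))) ,
    ≡-trans (+-identityʳ (length Π)) (≡-trans (↭-length Π↭Π₀) (sym (+-identityʳ (length (Πs zero)))))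
    where
      open Wedge wedge
      in-block₀ : ∀ {v} → ∃ (λ i → v ∈ Πs i) → v ∈ Πs zero
      in-block₀ (zero , v∈) = v∈
      Π↭Π₀ : Π ↭ Πs zero
      Π↭Π₀ = unique-set⇒↭ unique (blocks-unique zero) (in-block₀ ∘ covered) (included zero)
      term-[_] : ∀ r → term Πs (r ∷ []) ≡ #chambers (Πs zero) r
      term-[ r ] rewrite multinomial-[ r ] | multinomial-[ length (Πs zero) ∸ r ∸ 1 ] =
        ≡-trans (*-identityʳ _) (≡-trans (*-identityʳ _) (*-identityʳ _))

  wedge-count-step : ∀ {k} {Πs : Fin (suc (suc k)) → List A} {Π} (wedge : Wedge Πs Π) →
    WedgeCount k (Πs ∘ suc) (tail-union Πs Π) → WedgeCount (suc k) Πs Π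
  wedge-count-step {k} {Πs} {Π} wedge (#tail≡ , |tail|≡) = #chambers≡ , length≡
    where
      open Wedge wedge
      Π′ : List A
      Π′ = tail-union Πs Π
      gaps≡ : ∀ v → prod#chambers (Πs ∘ suc) v ≢ 0 → vsum (gaps (lengths (Πs ∘ suc)) v) ≡ length Π′ ∸ 1 ∸ vsum v
      gaps≡ v P≢0 = begin
        G                                      ≡⟨ m+[1+n]∸1∸n≡m G (vsum v) ⟨
        G + suc (vsum v) ∸ 1 ∸ vsum v          ≡⟨ cong (λ t → t ∸ 1 ∸ vsum v) (+-cancelʳ-≡ k _ _ sizes) ⟩
        length Π′ ∸ 1 ∸ vsum v                 ∎
        where
          open ≡-Reasoning
          G : ℕ
          G = vsum (gaps (lengths (Πs ∘ suc)) v)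
          shift-suc : ∀ a b k → a + suc b + k ≡ a + b + suc k
          shift-suc = solve-∀
          sizes : G + suc (vsum v) + k ≡ length Π′ + k
          sizes = ≡-trans (shift-suc G (vsum v) k)
            (≡-trans (vsum-gaps (prod#chambers≢0⇒< (Πs ∘ suc) (α∈blocks ∘ suc) v P≢0)) (sym |tail|≡))
      glue-block : ∀ j s → #chambers (Πs zero) j * (#chambers Π′ s *
          (#shuffles (length (Πs zero) ∸ 1 ∸ j) (length Π′ ∸ 1 ∸ s) * #shuffles j s))
        ≡ sumComp (suc k) s (λ v → term Πs (j ∷ v))
      glue-block j s = begin
          C * (#chambers Π′ s * B)
        ≡⟨ cong (λ t → C * (t * B)) (#tail≡ s) ⟩
          C * (sumComp (suc k) s (term (Πs ∘ suc)) * B)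
        ≡⟨ regroup C (sumComp (suc k) s (term (Πs ∘ suc))) B ⟩
          C * B * sumComp (suc k) s (term (Πs ∘ suc))
        ≡⟨ sumComp-*ˡ (suc k) s (C * B) (term (Πs ∘ suc)) ⟨
          sumComp (suc k) s (λ v → C * B * term (Πs ∘ suc) v)
        ≡⟨ sumComp-cong (suc k) s _ _ (λ v Σv≡s → subst (λ t → C * (#shuffles (length (Πs zero) ∸ 1 ∸ j) (length Π′ ∸ 1 ∸ t) * #shuffles j t)
                                                                 * term (Πs ∘ suc) v ≡ term Πs (j ∷ v))
                                                        Σv≡s (term-∷ Πs (length Π′) j v (gaps≡ v))) ⟩
          sumComp (suc k) s (λ v → term Πs (j ∷ v)) ∎
        where
          open ≡-Reasoning
          C B : ℕ
          C = #chambers (Πs zero) j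
          B = #shuffles (length (Πs zero) ∸ 1 ∸ j) (length Π′ ∸ 1 ∸ s) * #shuffles j s
          regroup : ∀ C S B → C * (S * B) ≡ C * B * S
          regroup = solve-∀
      #chambers≡ : ∀ r → #chambers Π r ≡ sumComp (suc (suc k)) r (term Πs)
      #chambers≡ r = ≡-trans (#chambers-glued wedge r) (sumUpTo-cong r (λ j _ → glue-block j (r ∸ j)))
      length≡ : length Π + suc k ≡ vsum (lengths Πs)
      length≡ = begin
        length Π + suc k                   ≡⟨ +-suc (length Π) k ⟩
        suc (length Π + k)                 ≡⟨ cong (_+ k) (+-comm 1 (length Π)) ⟩
        length Π + 1 + k                   ≡⟨ cong (_+ k) (length-glued wedge) ⟩
        length (Πs zero) + length Π′ + k   ≡⟨ +-assoc (length (Πs zero)) (length Π′) k ⟩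
        length (Πs zero) + (length Π′ + k) ≡⟨ cong (length (Πs zero) +_) |tail|≡ ⟩
        vsum (lengths Πs)                  ∎
        where open ≡-Reasoning

  wedge-count : ∀ k {Πs : Fin (suc k) → List A} {Π} → Wedge Πs Π → WedgeCount k Πs Π
  wedge-count zero    wedge = wedge-count-single wedge
  wedge-count (suc k) wedge = wedge-count-step wedge (wedge-count k (tail-wedge wedge))

  block-length≤ : ∀ {k} {Πs : Fin k → List A} {Π} → Wedge Πs Π → ∀ i → length (Πs i) ≤ length Π
  block-length≤ {Πs = Πs} {Π} wedge i =
    subst (_≤ length Π) (↭-length (restrict-↭ unique (blocks-unique i) (included i) ↭-refl)) (length-filter (_∈? Πs i) Π)
    where open Wedge wedge

  #respecting≡sumUpTo : ∀ {Π} N → α ∈ Π → length Π ≤ N → length (filterᵇ (respects o) (perms Π)) ≡ sumUpTo N (#chambers Π)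
  #respecting≡sumUpTo {Π} N α∈Π |Π|≤N = length-filterᵇ-by-value (respects o) (after _≟_ α) N (perms Π) after≤N
    where
      after≤N : ∀ {c} → c ∈ perms Π → T (respects o c) → after _≟_ α c ≤ N
      after≤N {c} c∈ _ = ≤-trans (<⇒≤ (subst (after _≟_ α c <_) (↭-length (∈-perms⁻ Π c∈))
        (after<length c (∈-resp-↭ (↭-sym (∈-perms⁻ Π c∈)) α∈Π)))) |Π|≤N

  #respecting≡sumBox : ∀ k {Π} N (f : Vec ℕ (suc k) → ℕ) → α ∈ Π → length Π ≤ N →
    (∀ r → #chambers Π r ≡ sumComp (suc k) r f) → (∀ v → OutsideBox N v → f v ≡ 0) →
    length (filterᵇ (respects o) (perms Π)) ≡ sumBox (suc k) N f
  #respecting≡sumBox k N f α∈Π |Π|≤N #≡ f≡0 =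
    ≡-trans (#respecting≡sumUpTo (suc k * N) α∈Π (≤-trans |Π|≤N (m≤m+n N (k * N))))
            (≡-trans (sumUpTo-cong (suc k * N) (λ r _ → #≡ r)) (sumBox≡sumUpTo-sumComp (suc k) N f f≡0))

module _ {A : Set} (_≟_ : DecidableEquality A) (o : A → A → Bool) (α : A) where

  open Arrangements _≟_ using (∈-perms⁻)
  open Chambers _≟_ o α

  restrict-on-block : ∀ {k} (Γs : Fin k → Graph {A}) →
    (∀ i j → i ≢ j → ∀ v → v ∈ verts (Γs i) → v ∈ verts (Γs j) → v ≡ α) →
    (∀ a b → o a b ≡ true → ∃ λ i → adj (Γs i) a b ≡ true) →
    ∀ i {a b} → a ∈ verts (Γs i) → b ∈ verts (Γs i) → restrict o (Γs i) a b ≡ o a b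
  restrict-on-block Γs meet o-in-blocks i {a} {b} a∈ b∈ with o a b in oab
  ... | false = refl
  ... | true with o-in-blocks a b oab
  ...   | j , adjʲ with i Fin.≟ j
  ...     | yes refl = adjʲ
  ...     | no i≢j with adj-in (Γs j) a b adjʲ
  ...       | a∈ʲ , b∈ʲ with meet i j i≢j a a∈ a∈ʲ | meet i j i≢j b b∈ b∈ʲ
  ...         | refl | refl with ≡-trans (sym adjʲ) (adj-irr (Γs j) α)
  ...           | ()

  prodσ≡prod#chambers : ∀ {k} (Γs : Fin k → Graph {A}) →
    (∀ i {a b} → a ∈ verts (Γs i) → b ∈ verts (Γs i) → restrict o (Γs i) a b ≡ o a b) →
    ∀ rs → prodσ _≟_ Γs o α rs ≡ prod#chambers (verts ∘ Γs) rs
  prodσ≡prod#chambers Γs agree []       = refl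
  prodσ≡prod#chambers Γs agree (r ∷ rs) =
    cong₂ _*_ (cong length (filterᵇ-cong-local _ _ (perms V) same-test)) (prodσ≡prod#chambers (Γs ∘ suc) (λ i → agree (suc i)) rs)
    where
      V : List A
      V = verts (Γs zero)
      same-test : ∀ {c} → c ∈ perms V →
        (respects (restrict o (Γs zero)) c ∧ (after _≟_ α c ≡ᵇ r)) ≡ (respects o c ∧ (after _≟_ α c ≡ᵇ r))
      same-test {c} c∈ = cong (_∧ (after _≟_ α c ≡ᵇ r)) (respects-cong (restrict o (Γs zero)) o c
        (λ a∈ b∈ → agree zero (∈-resp-↭ (∈-perms⁻ V c∈) a∈) (∈-resp-↭ (∈-perms⁻ V c∈) b∈)))

  graph-wedge : ∀ {k} (Γs : Fin k → Graph {A}) (Γ : Graph {A}) →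
    (∀ i → α ∈ verts (Γs i)) →
    (∀ i j → i ≢ j → ∀ v → v ∈ verts (Γs i) → v ∈ verts (Γs j) → v ≡ α) →
    (∀ v → v ∈ verts Γ ⇔ ∃ (λ i → v ∈ verts (Γs i))) →
    (∀ a b → adj Γ a b ≡ true ⇔ ∃ (λ i → adj (Γs i) a b ≡ true)) →
    (∀ a b → o a b ≡ true → adj Γ a b ≡ true) →
    Wedge (verts ∘ Γs) (verts Γ)
  graph-wedge Γs Γ α∈ meet verts⇔ adj⇔ on-edges = record
    { blocks-unique = λ i → uniq (Γs i)
    ; α∈blocks      = α∈
    ; blocks-meet   = λ i j i≢j {v} → meet i j i≢j v
    ; unique        = uniq Γ
    ; covered       = λ {v} → Equivalence.to (verts⇔ v)
    ; included      = λ i {v} v∈ → Equivalence.from (verts⇔ v) (i , v∈)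
    ; o-local       = o-local
    }
    where
      o-local : ∀ {a b} → a ∈ verts Γ → b ∈ verts Γ → T (o a b) → ∃ λ i → a ∈ verts (Γs i) × b ∈ verts (Γs i)
      o-local {a} {b} _ _ oab with Equivalence.to (adj⇔ a b) (on-edges a b (Equivalence.to T-≡ oab))
      ... | i , adjⁱ = i , adj-in (Γs i) a b adjⁱ

mainTheorem1 : ∀ {A : Set} (_≟_ : DecidableEquality A) (k : ℕ) → 1 ≤ k →
    (Γs : Fin k → Graph {A}) (α : A) →
    (∀ i → α ∈ verts (Γs i)) →
    (∀ i j → i ≢ j → ∀ v → v ∈ verts (Γs i) → v ∈ verts (Γs j) → v ≡ α) →
    (Γ : Graph {A}) →
    (∀ v → v ∈ verts Γ ⇔ ∃ (λ i → v ∈ verts (Γs i))) →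
    (∀ a b → adj Γ a b ≡ true ⇔ ∃ (λ i → adj (Γs i) a b ≡ true)) →
    (o : A → A → Bool) → IsAcyclicOrientation Γ o →
    let l = #V Γ
        ls : Vec ℕ k
        ls = tabulate (λ i → #V (Γs i))
        term : Vec ℕ k → ℕ
        term rs = prodσ _≟_ Γs o α rs
                  * multinomial rs
                  * multinomial (zipWith (λ li ri → li ∸ ri ∸ 1) ls rs)
    in ((r : ℕ) → σ-at _≟_ Γ o α r ≡ sumComp k r term)
       × ((N : ℕ) → l ≤ N → σ _≟_ Γ o ≡ sumBox k N term)
mainTheorem1 _≟_ (suc k) _ Γs α α∈ meet Γ verts⇔ adj⇔ o orientation = count-at , count-total
  where
    open Chambers _≟_ o α
    wedge : Wedge (verts ∘ Γs) (verts Γ)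
    wedge = graph-wedge _≟_ o α Γs Γ α∈ meet verts⇔ adj⇔ (IsAcyclicOrientation.only-edges orientation)
    agree : ∀ i {a b} → a ∈ verts (Γs i) → b ∈ verts (Γs i) → restrict o (Γs i) a b ≡ o a b
    agree = restrict-on-block _≟_ o α Γs meet
      (λ a b oab → Equivalence.to (adj⇔ a b) (IsAcyclicOrientation.only-edges orientation a b oab))
    term′ : Vec ℕ (suc k) → ℕ
    term′ rs = prodσ _≟_ Γs o α rs * multinomial rs * multinomial (gaps (lengths (verts ∘ Γs)) rs)
    term≡ : ∀ rs → term (verts ∘ Γs) rs ≡ term′ rs
    term≡ rs = cong (λ P → P * multinomial rs * multinomial (gaps (lengths (verts ∘ Γs)) rs))
                    (sym (prodσ≡prod#chambers _≟_ o α Γs agree rs))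
    count-at : ∀ r → σ-at _≟_ Γ o α r ≡ sumComp (suc k) r term′
    count-at r = ≡-trans (proj₁ (wedge-count k wedge) r) (sumComp-cong (suc k) r _ _ (λ v _ → term≡ v))
    count-total : ∀ N → #V Γ ≤ N → σ _≟_ Γ o ≡ sumBox (suc k) N term′
    count-total N l≤N = #respecting≡sumBox k N term′ (Wedge.included wedge zero (α∈ zero)) l≤N count-at
      (λ v out → ≡-trans (sym (term≡ v))
        (term-outside-box (verts ∘ Γs) N α∈ (λ i → ≤-trans (block-length≤ wedge i) l≤N) v out))
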